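{- Let $$S_1(t,q)=\sum_{n\ge 0}\ \sum_{\sigma} t^{n} q^{\,d(\sigma,\,12\cdots n)},$$ where the inner sum ranges over the one-stack sortable permutations $\sigma$ of $\{1,\dots,n\}$. Then, as formal power series, $$S_1(t,q)=\frac{1+(q^2-1)t-\sqrt{(q^2-1)^2t^2-2(q^2+1)t+1}}{2tq^2}.$$
   Context: Permutations are written as words. One-stack sortable permutations: the empty word is one; a permutation $\sigma$ of $\{1,\dots,n\}$, $n\ge1$, is one if $\sigma=I\,n\,J$ for some $0\le p\le n-1$, with $I$ a one-stack sortable permutation of $\{1,\dots,p\}$ and $J$ a word on $\{p+1,\dots,n-1\}$ that becomes one-stack sortable after subtracting $p$ from each letter. A factor of $\sigma$ is a word of consecutive letters; it is compact if its letters form an integer interval; a factor $f$ is complete if it is compact and there is no nonempty factor $g$ with $fg$ a factor of $\sigma$ that is compact and has the same largest letter as $f$. For a word $w$ and integer $a$, $\overline{w}^{a}$ is obtained by adding $1$ to each letter $\ge a$. Deletion $(\sigma_k\to\Lambda)$: remove $\sigma_k$ and decrease by $1$ all letters greater than $\sigma_k$. Insertion: $(\Lambda\to\varnothing)$ maps the empty word to $(1)$; for $\sigma=ufv$ nonempty with $f$ a complete factor, $(\Lambda\to f)$ gives $\overline{u}^{a}af\overline{v}^{a}$ and $(\Lambda\overset{r}{\to}f)$ gives $\overline{u}^{a}fa\overline{v}^{a}$, with $a=\max f+1$, and $(\Lambda\overset{l}{\to}f)$ gives $\overline{u}^{a}a\overline{f}^{a}\overline{v}^{a}$ with $a=\min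 f$. The distance $d(\sigma_1,\sigma_2)$ is the minimal number of deletions and insertions transforming $\sigma_1$ into $\sigma_2$; $12\cdots n$ denotes the identity permutation (the empty word for $n=0$). The square root denotes the formal power series in $t$ with constant term $1$. -}

module Defs where

open import Data.Nat as ℕ using (ℕ; zero; suc; _≤_; _<_; _∸_; _⊔_; _⊓_; _<ᵇ_; _≤ᵇ_)
open import Data.Integer as ℤ using (ℤ; +_)
open import Data.List using (List; []; _∷_; _++_; map; foldr; concatMap; upTo)
open import Data.List.Membership.Propositional using (_∈_)
open import Data.List.Relation.Unary.All using (All)
open import Data.Bool using (if_then_else_)
open import Data.Product using (Σ; _×_; ∃)
open import Data.Empty using (⊥)
open import Relation.Nullary using (¬_)
open import Relation.Binary.PropositionalEquality using (_≡_; _≢_)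

idPerm : ℕ → List ℕ
idPerm n = map suc (upTo n)

insertAll : ℕ → List ℕ → List (List ℕ)
insertAll x []       = (x ∷ []) ∷ []
insertAll x (y ∷ ys) = (x ∷ y ∷ ys) ∷ map (y ∷_) (insertAll x ys)

perms : ℕ → List (List ℕ)
perms zero    = [] ∷ []
perms (suc n) = concatMap (insertAll (suc n)) (perms n)

-- OneStack n w : w is a one-stack sortable permutation of {1,...,n}
-- (literally the recursive definition: w = I n J)
data OneStack : ℕ → List ℕ → Set where
  os-empty : OneStack zero []
  os-split : ∀ {n} (p : ℕ) (I J : List ℕ) →
             p ≤ n →
             OneStack p I →
             All (λ x → p < x) J →
             OneStack (n ∸ p) (map (λ x → x ∸ p) J) →
             OneStack (suc n) (I ++ suc n ∷ J)

maxL : List ℕ → ℕ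
maxL = foldr _⊔_ 0

Compact : List ℕ → Set
Compact w = Σ ℕ λ lo → Σ ℕ λ hi →
  (∀ x → x ∈ w → lo ≤ x × x ≤ hi) × (∀ x → lo ≤ x → x ≤ hi → x ∈ w)

Complete : List ℕ → List ℕ → List ℕ → Set
Complete u f v = Compact f ×
  (∀ (g v' : List ℕ) → v ≡ g ++ v' → g ≢ [] →
     Compact (f ++ g) → maxL (f ++ g) ≡ maxL f → ⊥)

bar : ℕ → List ℕ → List ℕ
bar a = map (λ y → if a ≤ᵇ y then suc y else y)

dropAbove : ℕ → List ℕ → List ℕ
dropAbove x = map (λ y → if x <ᵇ y then y ∸ 1 else y)

data Step : List ℕ → List ℕ → Set where
  del  : ∀ u x v → Step (u ++ x ∷ v) (dropAbove x (u ++ v))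
  ins∅ : Step [] (1 ∷ [])
  insA : ∀ u y ys v → Complete u (y ∷ ys) v →
         Step (u ++ (y ∷ ys) ++ v)
              (bar (suc (maxL (y ∷ ys))) u ++ suc (maxL (y ∷ ys)) ∷ (y ∷ ys)
                 ++ bar (suc (maxL (y ∷ ys))) v)
  insR : ∀ u y ys v → Complete u (y ∷ ys) v →
         Step (u ++ (y ∷ ys) ++ v)
              (bar (suc (maxL (y ∷ ys))) u ++ (y ∷ ys)
                 ++ suc (maxL (y ∷ ys)) ∷ bar (suc (maxL (y ∷ ys))) v)
  insL : ∀ u y ys v → Complete u (y ∷ ys) v →
         Step (u ++ (y ∷ ys) ++ v)
              (bar (foldr _⊓_ y ys) u ++ foldr _⊓_ y ys ∷ bar (foldr _⊓_ y ys) (y ∷ ys)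
                 ++ bar (foldr _⊓_ y ys) v)

data Path : ℕ → List ℕ → List ℕ → Set where
  here : ∀ {σ} → Path zero σ σ
  step : ∀ {k σ ρ τ} → Step σ ρ → Path k ρ τ → Path (suc k) σ τ

Dist : List ℕ → List ℕ → ℕ → Set
Dist σ τ k = Path k σ τ × (∀ j → Path j σ τ → k ≤ j)

data CountIs {A : Set} (P : A → Set) : List A → ℕ → Set where
  cnt-nil  : CountIs P [] zero
  cnt-yes  : ∀ {x xs m} → P x → CountIs P xs m → CountIs P (x ∷ xs) (suc m)
  cnt-no   : ∀ {x xs m} → ¬ P x → CountIs P xs m → CountIs P (x ∷ xs) m

-- Formal power series in t and q with integer coefficients
-- (Series n k = coefficient of t^n q^k); ℤ[q][[t]] embeds in ℤ[[t,q]].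

Series : Set
Series = ℕ → ℕ → ℤ

_≈_ : Series → Series → Set
f ≈ g = ∀ n k → f n k ≡ g n k

sumTo : ℕ → (ℕ → ℤ) → ℤ
sumTo zero    h = h zero
sumTo (suc n) h = sumTo n h ℤ.+ h (suc n)

_⊕_ : Series → Series → Series
(f ⊕ g) n k = f n k ℤ.+ g n k

_⊖_ : Series → Series → Series
(f ⊖ g) n k = f n k ℤ.- g n k

_⊛_ : Series → Series → Series
(f ⊛ g) n k = sumTo n (λ i → sumTo k (λ j → f i j ℤ.* g (n ∸ i) (k ∸ j)))

_·_ : ℤ → Series → Series
(c · f) n k = c ℤ.* f n k

infix 4 _≈_
infixl 6 _⊕_ _⊖_
infixl 7 _⊛_
infixr 8 _·_

mono : ℕ → ℕ → Series
mono a b n k = if (n ℕ.≡ᵇ a) Data.Bool.∧ (k ℕ.≡ᵇ b) then + 1 else + 0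

one T Q² : Series
one = mono 0 0
T   = mono 1 0
Q²  = mono 0 2

ConstOne : Series → Set
ConstOne r = r 0 0 ≡ + 1 × (∀ k → r 0 (suc k) ≡ + 0)

radicand : Series
radicand = (Q² ⊖ one) ⊛ (Q² ⊖ one) ⊛ T ⊛ T ⊖ (+ 2) · (Q² ⊕ one) ⊛ T ⊕ one

IsSqrt : Series → Set
IsSqrt r = ConstOne r × (r ⊛ r ≈ radicand)

numerator : Series → Series
numerator r = one ⊕ (Q² ⊖ one) ⊛ T ⊖ r

fromCoeffs : (ℕ → ℕ → ℕ) → Series
fromCoeffs c n k = + c n k

{-# OPTIONS --safe #-}
module Submission where

-- A one-stack sortable σ of length n is at distance 2·des σ from the identity. No operation
-- lowers 2·des − length by more than one (an insertion never removes a descent, a deletion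
-- removes at most one), which gives the lower bound. For the upper bound write σ = I n J:
-- if J is empty, sorting I sorts σ; otherwise deleting n removes the descent before J, and
-- after sorting the rest n is put back at the end in one insertion (Λ →r f) with f the
-- whole identity. The decomposition σ = I n J also gives 2·des σ = 2·des I + (2 + 2·des J,
-- or 0 if J is empty), hence F = 1 + tF(1 + q²(F − 1)) for F = S₁(t,q). Completing the
-- square, r = 1 + (q²−1)t − 2tq²F squares to the radicand and has constant term 1, and a
-- square root with constant term 1 is unique since (r − s)(r + s) = 0 and r + s has constant term 2.

open import Algebra.Bundles using (CommutativeSemiring; CommutativeRing)
open import Data.Nat.Base as ℕ using (ℕ; zero; suc; _∸_; _≤_; _<_; z≤n; s≤s)
import Data.Nat.Properties as ℕₚ
open import Data.Sum.Base using (inj₁; inj₂)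
open import Relation.Binary.PropositionalEquality as ≡ using (_≡_; _≢_)

module Sums {c ℓ} (S : CommutativeSemiring c ℓ) where

  open CommutativeSemiring S hiding (zero)
  open import Relation.Binary.Reasoning.Setoid setoid
  open import Algebra.Properties.CommutativeSemigroup +-commutativeSemigroup using (interchange)

  sumTo : ℕ → (ℕ → Carrier) → Carrier
  sumTo zero    f = f zero
  sumTo (suc n) f = sumTo n f + f (suc n)

  sumTo-cong : ∀ n {f g} → (∀ {i} → i ≤ n → f i ≈ g i) → sumTo n f ≈ sumTo n g
  sumTo-cong zero    f≈g = f≈g z≤n
  sumTo-cong (suc n) f≈g =
    +-cong (sumTo-cong n (λ i≤n → f≈g (ℕₚ.m≤n⇒m≤1+n i≤n))) (f≈g ℕₚ.≤-refl)

  sumTo-zero : ∀ n {f} → (∀ {i} → i ≤ n → f i ≈ 0#) → sumTo n f ≈ 0#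
  sumTo-zero zero    f≈0 = f≈0 z≤n
  sumTo-zero (suc n) f≈0 =
    trans (+-cong (sumTo-zero n (λ i≤n → f≈0 (ℕₚ.m≤n⇒m≤1+n i≤n))) (f≈0 ℕₚ.≤-refl))
          (+-identityˡ 0#)

  sumTo-single : ∀ n {a} f → a ≤ n → (∀ {i} → i ≤ n → i ≢ a → f i ≈ 0#) → sumTo n f ≈ f a
  sumTo-single zero    f z≤n _ = refl
  sumTo-single (suc n) f a≤1+n f≈0 with ℕₚ.m≤n⇒m<n∨m≡n a≤1+n
  ... | inj₂ ≡.refl =
    trans (+-congʳ (sumTo-zero n (λ i≤n → f≈0 (ℕₚ.m≤n⇒m≤1+n i≤n) (ℕₚ.<⇒≢ (s≤s i≤n)))))
          (+-identityˡ _)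
  ... | inj₁ (s≤s a≤n) =
    trans (+-cong (sumTo-single n f a≤n (λ i≤n → f≈0 (ℕₚ.m≤n⇒m≤1+n i≤n)))
                  (f≈0 ℕₚ.≤-refl (ℕₚ.>⇒≢ (s≤s a≤n))))
          (+-identityʳ _)

  sumTo-+ : ∀ n f g → sumTo n (λ i → f i + g i) ≈ sumTo n f + sumTo n g
  sumTo-+ zero    f g = refl
  sumTo-+ (suc n) f g = trans (+-congʳ (sumTo-+ n f g)) (interchange _ _ _ _)

  *-distribˡ-sumTo : ∀ n a f → a * sumTo n f ≈ sumTo n (λ i → a * f i)
  *-distribˡ-sumTo zero    a f = refl
  *-distribˡ-sumTo (suc n) a f = trans (distribˡ a _ _) (+-congʳ (*-distribˡ-sumTo n a f))

  *-distribʳ-sumTo : ∀ n a f → sumTo n f * a ≈ sumTo n (λ i → f i * a)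
  *-distribʳ-sumTo zero    a f = refl
  *-distribʳ-sumTo (suc n) a f = trans (distribʳ a _ _) (+-congʳ (*-distribʳ-sumTo n a f))

  sumTo-sucˡ : ∀ n f → sumTo (suc n) f ≈ f 0 + sumTo n (λ i → f (suc i))
  sumTo-sucˡ zero    f = refl
  sumTo-sucˡ (suc n) f = trans (+-congʳ (sumTo-sucˡ n f)) (+-assoc _ _ _)

  sumTo-reverse : ∀ n f → sumTo n f ≈ sumTo n (λ i → f (n ∸ i))
  sumTo-reverse zero    f = refl
  sumTo-reverse (suc n) f = begin
    sumTo n f + f (suc n)                  ≈⟨ +-congʳ (sumTo-reverse n f) ⟩
    sumTo n (λ i → f (n ∸ i)) + f (suc n)  ≈⟨ +-comm _ _ ⟩
    f (suc n) + sumTo n (λ i → f (n ∸ i))  ≈⟨ sumTo-sucˡ n (λ i → f (suc n ∸ i)) ⟨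
    sumTo (suc n) (λ i → f (suc n ∸ i))    ∎

  sumTo-triangle : ∀ n (F : ℕ → ℕ → Carrier) →
    sumTo n (λ m → sumTo m (λ i → F i m)) ≈ sumTo n (λ i → sumTo (n ∸ i) (λ j → F i (i ℕ.+ j)))
  sumTo-triangle zero    F = refl
  sumTo-triangle (suc n) F = begin
    sumTo n (λ m → sumTo m (λ i → F i m)) + (sumTo n (λ i → F i (suc n)) + F (suc n) (suc n))
      ≈⟨ +-congʳ (sumTo-triangle n F) ⟩
    sumTo n (λ i → sumTo (n ∸ i) (G i)) + (sumTo n (λ i → F i (suc n)) + F (suc n) (suc n))
      ≈⟨ +-assoc _ _ _ ⟨
    (sumTo n (λ i → sumTo (n ∸ i) (G i)) + sumTo n (λ i → F i (suc n))) + F (suc n) (suc n)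
      ≈⟨ +-congʳ (sumTo-+ n _ _) ⟨
    sumTo n (λ i → sumTo (n ∸ i) (G i) + F i (suc n)) + F (suc n) (suc n)
      ≈⟨ +-cong (sumTo-cong n extendRow) (reflexive (≡.cong (F (suc n)) (≡.sym (ℕₚ.+-identityʳ (suc n))))) ⟩
    sumTo n (λ i → sumTo (suc n ∸ i) (G i)) + G (suc n) 0
      ≈⟨ +-congˡ (reflexive (≡.cong (λ m → sumTo m (G (suc n))) (≡.sym (ℕₚ.n∸n≡0 n)))) ⟩
    sumTo (suc n) (λ i → sumTo (suc n ∸ i) (G i)) ∎
    where
    G : ℕ → ℕ → Carrier
    G i j = F i (i ℕ.+ j)
    extendRow : ∀ {i} → i ≤ n → sumTo (n ∸ i) (G i) + F i (suc n) ≈ sumTo (suc n ∸ i) (G i)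
    extendRow {i} i≤n rewrite ℕₚ.+-∸-assoc 1 i≤n = +-congˡ (reflexive (≡.cong (F i)
      (≡.trans (≡.cong suc (≡.sym (ℕₚ.m+[n∸m]≡n i≤n))) (≡.sym (ℕₚ.+-suc i (n ∸ i))))))

module PowerSeries {c ℓ} (R : CommutativeRing c ℓ) where

  open CommutativeRing R hiding (zero)
  open Sums commutativeSemiring
  open import Relation.Binary.Reasoning.Setoid setoid
  open import Data.Product.Base using (_,_)
  import Algebra.Construct.Pointwise ℕ as Pointwise

  PowerSeries : Set c
  PowerSeries = ℕ → Carrier

  infix  4 _≋_
  infixl 6 _⊞_
  infixl 7 _⋆_

  _≋_ : PowerSeries → PowerSeries → Set ℓ
  f ≋ g = ∀ n → f n ≈ g n

  _⊞_ : PowerSeries → PowerSeries → PowerSeries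
  (f ⊞ g) n = f n + g n

  ⊟_ : PowerSeries → PowerSeries
  (⊟ f) n = - f n

  𝟘 𝟙 : PowerSeries
  𝟘 _       = 0#
  𝟙 zero    = 1#
  𝟙 (suc _) = 0#

  _⋆_ : PowerSeries → PowerSeries → PowerSeries
  (f ⋆ g) n = sumTo n (λ i → f i * g (n ∸ i))

  ⋆-cong : ∀ {f f′ g g′} → f ≋ f′ → g ≋ g′ → f ⋆ g ≋ f′ ⋆ g′
  ⋆-cong f≋f′ g≋g′ n = sumTo-cong n (λ {i} _ → *-cong (f≋f′ i) (g≋g′ (n ∸ i)))

  ⋆-comm : ∀ f g → f ⋆ g ≋ g ⋆ f
  ⋆-comm f g n = trans (sumTo-reverse n _) (sumTo-cong n (λ {i} i≤n →
    trans (*-comm _ _) (*-congʳ (reflexive (≡.cong g (ℕₚ.m∸[m∸n]≡n i≤n))))))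

  ⋆-identityˡ : ∀ f → 𝟙 ⋆ f ≋ f
  ⋆-identityˡ f zero    = *-identityˡ _
  ⋆-identityˡ f (suc n) = begin
    sumTo (suc n) (λ i → 𝟙 i * f (suc n ∸ i))
      ≈⟨ sumTo-sucˡ n _ ⟩
    1# * f (suc n) + sumTo n (λ i → 0# * f (n ∸ i))
      ≈⟨ +-cong (*-identityˡ _) (sumTo-zero n (λ _ → zeroˡ _)) ⟩
    f (suc n) + 0#
      ≈⟨ +-identityʳ _ ⟩
    f (suc n) ∎

  ⋆-distribˡ : ∀ f g h → f ⋆ (g ⊞ h) ≋ f ⋆ g ⊞ f ⋆ h
  ⋆-distribˡ f g h n = trans (sumTo-cong n (λ _ → distribˡ _ _ _)) (sumTo-+ n _ _)

  ⋆-assoc : ∀ f g h → (f ⋆ g) ⋆ h ≋ f ⋆ (g ⋆ h)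
  ⋆-assoc f g h n = begin
    sumTo n (λ m → sumTo m (λ i → f i * g (m ∸ i)) * h (n ∸ m))
      ≈⟨ sumTo-cong n (λ {m} _ → *-distribʳ-sumTo m _ _) ⟩
    sumTo n (λ m → sumTo m (λ i → f i * g (m ∸ i) * h (n ∸ m)))
      ≈⟨ sumTo-triangle n _ ⟩
    sumTo n (λ i → sumTo (n ∸ i) (λ j → f i * g ((i ℕ.+ j) ∸ i) * h (n ∸ (i ℕ.+ j))))
      ≈⟨ sumTo-cong n (λ {i} _ → sumTo-cong (n ∸ i) (λ {j} _ → trans (*-assoc _ _ _)
           (*-congˡ (*-cong (reflexive (≡.cong g (ℕₚ.m+n∸m≡n i j)))
                            (reflexive (≡.cong h (≡.sym (ℕₚ.∸-+-assoc n i j)))))))) ⟩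
    sumTo n (λ i → sumTo (n ∸ i) (λ j → f i * (g j * h (n ∸ i ∸ j))))
      ≈⟨ sumTo-cong n (λ {i} _ → *-distribˡ-sumTo (n ∸ i) _ _) ⟨
    sumTo n (λ i → f i * sumTo (n ∸ i) (λ j → g j * h (n ∸ i ∸ j)))
      ∎

  commutativeRing : CommutativeRing c ℓ
  commutativeRing = record
    { Carrier = PowerSeries ; _≈_ = _≋_ ; _+_ = _⊞_ ; _*_ = _⋆_ ; -_ = ⊟_ ; 0# = 𝟘 ; 1# = 𝟙
    ; isCommutativeRing = record
      { isRing = record
        { +-isAbelianGroup = Pointwise.isAbelianGroup +-isAbelianGroup
        ; *-cong = ⋆-cong
        ; *-assoc = ⋆-assoc
        ; *-identity = ⋆-identityˡ , λ f n → trans (⋆-comm f 𝟙 n) (⋆-identityˡ f n)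
        ; distrib = ⋆-distribˡ , λ f g h n →
            trans (⋆-comm (g ⊞ h) f n) (trans (⋆-distribˡ f g h n) (+-cong (⋆-comm f g n) (⋆-comm f h n)))
        }
      ; *-comm = ⋆-comm
      }
    }

import Algebra.Solver.Ring
import Algebra.Solver.Ring.AlmostCommutativeRing as ACR
open import Data.Bool.Base using (true; false; if_then_else_; _∧_)
open import Data.Empty using (⊥)
open import Data.Integer.Base as ℤ using (ℤ; 0ℤ)
import Data.Integer.Properties as ℤₚ
open import Data.List.Base using (List; []; _∷_; _++_; [_]; map; foldr; length; upTo; applyUpTo; concat; concatMap)
import Data.List.Properties as Listₚ
open import Data.List.Membership.Propositional using (_∈_; find; lose)
open import Data.List.Membership.DecPropositional (Listₚ.≡-dec ℕₚ._≟_) using (_∈?_)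
import Data.List.Membership.Propositional.Properties as ∈ₚ
open import Data.List.Relation.Unary.All as All using (All; []; _∷_)
import Data.List.Relation.Unary.All.Properties as Allₚ
open import Data.List.Relation.Unary.AllPairs using ([]; _∷_)
open import Data.List.Relation.Unary.Any using (here; there)
open import Data.List.Relation.Unary.Unique.Propositional using (Unique)
import Data.List.Relation.Unary.Unique.Propositional.Properties as UniqueP
open import Data.Maybe.Base using (Maybe; just; nothing)
open import Data.Nat.Base using (_+_; _*_)
open import Data.Nat.Induction using (<-rec)
open import Data.Nat.ListAction using (sum)
open import Data.Nat.ListAction.Properties using (sum-++)
open import Data.Nat.Tactic.RingSolver using (solve-∀)
open import Data.Product.Base as Product using (Σ; ∃; ∃₂; _×_; _,_; proj₁; proj₂)
open import Data.Sum.Base using (_⊎_)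
open import Data.Unit.Base using (⊤; tt)
open import Function.Base using (_∘_)
open import Function.Bundles using (mk⇔)
open import Level using (0ℓ)
open import Relation.Binary.Definitions using (DecidableEquality; tri<; tri≈; tri>)
open ≡ using (refl; cong; cong₂; sym; trans; subst)
open import Relation.Nullary using (¬_; Dec; yes; no; contradiction)
open import Relation.Nullary.Decidable using (does; dec-true; dec-false; does-⇔; _×-dec_)
open import Defs

module ℕΣ = Sums ℕₚ.+-*-commutativeSemiring

-- Descents

indicator : ∀ {p} {P : Set p} → Dec P → ℕ
indicator P? = if does P? then 1 else 0

module _ {p} {P : Set p} (P? : Dec P) where

  indicator-yes : P → indicator P? ≡ 1
  indicator-yes x rewrite dec-true P? x = refl

  indicator-no : ¬ P → indicator P? ≡ 0
  indicator-no ¬x rewrite dec-false P? ¬x = refl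

  indicator≤1 : indicator P? ≤ 1
  indicator≤1 with does P?
  ... | true  = ℕₚ.≤-refl
  ... | false = z≤n

indicator-⇔ : ∀ {p q} {P : Set p} {Q : Set q} → (P → Q) → (Q → P) → (P? : Dec P) (Q? : Dec Q) →
              indicator P? ≡ indicator Q?
indicator-⇔ P→Q Q→P P? Q? = cong (if_then 1 else 0) (does-⇔ (mk⇔ P→Q Q→P) P? Q?)

descent : ℕ → ℕ → ℕ
descent x y = indicator (y ℕₚ.<? x)

desFrom : ℕ → List ℕ → ℕ
desFrom x []      = 0
desFrom x (y ∷ w) = descent x y + desFrom y w

des : List ℕ → ℕ
des []      = 0
des (x ∷ w) = desFrom x w

twiceDes : List ℕ → ℕ
twiceDes σ = des σ + des σ

descent-< : ∀ {x y} → y < x → descent x y ≡ 1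
descent-< {x} {y} = indicator-yes (y ℕₚ.<? x)

descent-≥ : ∀ {x y} → x ≤ y → descent x y ≡ 0
descent-≥ {x} {y} x≤y = indicator-no (y ℕₚ.<? x) (ℕₚ.≤⇒≯ x≤y)

descent≤1 : ∀ x y → descent x y ≤ 1
descent≤1 x y = indicator≤1 (y ℕₚ.<? x)

descent-triangle : ∀ x y z → descent x z ≤ descent x y + descent y z
descent-triangle x y z with z ℕₚ.<? x
... | no z≮x rewrite descent-≥ (ℕₚ.≮⇒≥ z≮x) = z≤n
... | yes z<x with y ℕₚ.<? x
...   | yes y<x rewrite descent-< z<x | descent-< y<x = s≤s z≤n
...   | no y≮x rewrite descent-< z<x | descent-< (ℕₚ.<-≤-trans z<x (ℕₚ.≮⇒≥ y≮x)) =
  ℕₚ.m≤n+m 1 (descent x y)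

descent-pair : ∀ x y z → descent x y + descent y z ≤ suc (descent x z)
descent-pair x y z with y ℕₚ.<? x | z ℕₚ.<? y
... | yes y<x | yes z<y rewrite descent-< y<x | descent-< z<y | descent-< (ℕₚ.<-trans z<y y<x) = ℕₚ.≤-refl
... | yes y<x | no z≮y  rewrite descent-< y<x | descent-≥ (ℕₚ.≮⇒≥ z≮y) = s≤s z≤n
... | no y≮x  | _       rewrite descent-≥ (ℕₚ.≮⇒≥ y≮x) = ℕₚ.≤-trans (descent≤1 y z) (s≤s z≤n)

desFrom-insert : ∀ x P a Q → desFrom x (P ++ Q) ≤ desFrom x (P ++ a ∷ Q)
desFrom-insert x []      a []      = z≤n
desFrom-insert x []      a (q ∷ Q) = begin
  descent x q + desFrom q Q                  ≤⟨ ℕₚ.+-monoˡ-≤ (desFrom q Q) (descent-triangle x a q) ⟩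
  descent x a + descent a q + desFrom q Q    ≡⟨ ℕₚ.+-assoc (descent x a) _ _ ⟩
  descent x a + (descent a q + desFrom q Q)  ∎
  where open ℕₚ.≤-Reasoning
desFrom-insert x (p ∷ P) a Q = ℕₚ.+-monoʳ-≤ (descent x p) (desFrom-insert p P a Q)

des-insert : ∀ P a Q → des (P ++ Q) ≤ des (P ++ a ∷ Q)
des-insert []      a []      = z≤n
des-insert []      a (q ∷ Q) = ℕₚ.m≤n+m (desFrom q Q) (descent a q)
des-insert (p ∷ P) a Q       = desFrom-insert p P a Q

desFrom-delete : ∀ x u y v → desFrom x (u ++ y ∷ v) ≤ suc (desFrom x (u ++ v))
desFrom-delete x []      y []      = ℕₚ.≤-trans (ℕₚ.≤-reflexive (ℕₚ.+-identityʳ _)) (descent≤1 x y)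
desFrom-delete x []      y (z ∷ v) = begin
  descent x y + (descent y z + desFrom z v)  ≡⟨ ℕₚ.+-assoc (descent x y) _ _ ⟨
  descent x y + descent y z + desFrom z v    ≤⟨ ℕₚ.+-monoˡ-≤ (desFrom z v) (descent-pair x y z) ⟩
  suc (descent x z + desFrom z v)            ∎
  where open ℕₚ.≤-Reasoning
desFrom-delete x (w ∷ u) y v = begin
  descent x w + desFrom w (u ++ y ∷ v)        ≤⟨ ℕₚ.+-monoʳ-≤ (descent x w) (desFrom-delete w u y v) ⟩
  descent x w + suc (desFrom w (u ++ v))      ≡⟨ ℕₚ.+-suc (descent x w) _ ⟩
  suc (descent x w + desFrom w (u ++ v))      ∎
  where open ℕₚ.≤-Reasoning

des-delete : ∀ u y v → des (u ++ y ∷ v) ≤ suc (des (u ++ v))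
des-delete []      y []      = z≤n
des-delete []      y (z ∷ v) = ℕₚ.+-monoˡ-≤ (desFrom z v) (descent≤1 y z)
des-delete (w ∷ u) y v       = desFrom-delete w u y v

desFrom-++ : ∀ x xs y ys → All (_< y) (x ∷ xs) → desFrom x (xs ++ y ∷ ys) ≡ desFrom x xs + des (y ∷ ys)
desFrom-++ x []        y ys (x<y ∷ _) rewrite descent-≥ (ℕₚ.<⇒≤ x<y) = refl
desFrom-++ x (x′ ∷ xs) y ys (_ ∷ x′∷xs<y) =
  trans (cong (descent x x′ +_) (desFrom-++ x′ xs y ys x′∷xs<y)) (sym (ℕₚ.+-assoc (descent x x′) _ _))

des-++ : ∀ xs y ys → All (_< y) xs → des (xs ++ y ∷ ys) ≡ des xs + des (y ∷ ys)
des-++ []       y ys _    = refl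
des-++ (x ∷ xs) y ys xs<y = desFrom-++ x xs y ys xs<y

des-++-larger : ∀ w {x} → All (_< x) w → des (w ++ [ x ]) ≡ des w
des-++-larger w w<x = trans (des-++ w _ [] w<x) (ℕₚ.+-identityʳ (des w))

des-remove-peak : ∀ I {x j} J → All (_< j) I → j < x → des (I ++ x ∷ j ∷ J) ≡ suc (des (I ++ j ∷ J))
des-remove-peak I {x} {j} J I<j j<x = begin
  des (I ++ x ∷ j ∷ J)            ≡⟨ des-++ I x (j ∷ J) (All.map (λ y<j → ℕₚ.<-trans y<j j<x) I<j) ⟩
  des I + (descent x j + desFrom j J) ≡⟨ cong (λ d → des I + (d + desFrom j J)) (descent-< j<x) ⟩
  des I + suc (des (j ∷ J))       ≡⟨ ℕₚ.+-suc (des I) _ ⟩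
  suc (des I + des (j ∷ J))       ≡⟨ cong suc (des-++ I j J I<j) ⟨
  suc (des (I ++ j ∷ J))          ∎
  where open ≡.≡-Reasoning

module StrictlyMonotoneOn {P : ℕ → Set} (f : ℕ → ℕ)
                          (f-mono : ∀ {x y} → P x → P y → x < y → f x < f y) where

  f-reflects-< : ∀ {x y} → P x → P y → f x < f y → x < y
  f-reflects-< {x} {y} px py fx<fy with ℕₚ.<-cmp x y
  ... | tri< x<y _ _ = x<y
  ... | tri≈ _ refl _ = contradiction fx<fy (ℕₚ.<-irrefl refl)
  ... | tri> _ _ y<x = contradiction fx<fy (ℕₚ.<-asym (f-mono py px y<x))

  f-injective : ∀ {x y} → P x → P y → f x ≡ f y → x ≡ y
  f-injective {x} {y} px py fx≡fy with ℕₚ.<-cmp x y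
  ... | tri< x<y _ _ = contradiction fx≡fy (ℕₚ.<⇒≢ (f-mono px py x<y))
  ... | tri≈ _ x≡y _ = x≡y
  ... | tri> _ _ y<x = contradiction fx≡fy (ℕₚ.>⇒≢ (f-mono py px y<x))

  descent-map : ∀ {x y} → P x → P y → descent (f x) (f y) ≡ descent x y
  descent-map {x} {y} px py = indicator-⇔ (f-reflects-< py px) (f-mono py px) (f y ℕₚ.<? f x) (y ℕₚ.<? x)

  desFrom-map : ∀ {x} w → P x → All P w → desFrom (f x) (map f w) ≡ desFrom x w
  desFrom-map []      px []        = refl
  desFrom-map (y ∷ w) px (py ∷ pw) = cong₂ _+_ (descent-map px py) (desFrom-map w py pw)

  des-map : ∀ w → All P w → des (map f w) ≡ des w
  des-map []      []        = refl
  des-map (x ∷ w) (px ∷ pw) = desFrom-map w px pw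

  unique-map : ∀ {w} → All P w → Unique w → Unique (map f w)
  unique-map []        []          = []
  unique-map (px ∷ pw) (x∉w ∷ uw) =
    Allₚ.map⁺ (All.zipWith (λ (x≢y , py) fx≡fy → x≢y (f-injective px py fx≡fy)) (x∉w , pw))
    ∷ unique-map pw uw

-- Elementary operations

≡ᵇ-true : ∀ {m n} → m ≡ n → (m ℕ.≡ᵇ n) ≡ true
≡ᵇ-true {m} {n} = dec-true (m ℕₚ.≟ n)

≡ᵇ-false : ∀ {m n} → m ≢ n → (m ℕ.≡ᵇ n) ≡ false
≡ᵇ-false {m} {n} = dec-false (m ℕₚ.≟ n)

≤ᵇ-true : ∀ {m n} → m ≤ n → (m ℕ.≤ᵇ n) ≡ true
≤ᵇ-true {m} {n} = dec-true (m ℕₚ.≤? n)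

≤ᵇ-false : ∀ {m n} → n < m → (m ℕ.≤ᵇ n) ≡ false
≤ᵇ-false {m} {n} n<m = dec-false (m ℕₚ.≤? n) (ℕₚ.<⇒≱ n<m)

<ᵇ-true : ∀ {m n} → m < n → (m ℕ.<ᵇ n) ≡ true
<ᵇ-true {m} {n} = dec-true (m ℕₚ.<? n)

<ᵇ-false : ∀ {m n} → n ≤ m → (m ℕ.<ᵇ n) ≡ false
<ᵇ-false {m} {n} n≤m = dec-false (m ℕₚ.<? n) (ℕₚ.≤⇒≯ n≤m)

liftAbove : ℕ → ℕ → ℕ
liftAbove a y = if a ℕ.≤ᵇ y then suc y else y

lowerAbove : ℕ → ℕ → ℕ
lowerAbove x y = if x ℕ.<ᵇ y then y ∸ 1 else y

liftAbove-≥ : ∀ {a y} → a ≤ y → liftAbove a y ≡ suc y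
liftAbove-≥ a≤y rewrite ≤ᵇ-true a≤y = refl

liftAbove-< : ∀ {a y} → y < a → liftAbove a y ≡ y
liftAbove-< y<a rewrite ≤ᵇ-false y<a = refl

liftAbove-mono : ∀ a {y z} → y < z → liftAbove a y < liftAbove a z
liftAbove-mono a {y} {z} y<z with a ℕₚ.≤? y | a ℕₚ.≤? z
... | yes a≤y | _ rewrite liftAbove-≥ a≤y | liftAbove-≥ (ℕₚ.≤-trans a≤y (ℕₚ.<⇒≤ y<z)) = s≤s y<z
... | no a≰y | yes a≤z rewrite liftAbove-< (ℕₚ.≰⇒> a≰y) | liftAbove-≥ a≤z = ℕₚ.m<n⇒m<1+n y<z
... | no a≰y | no a≰z rewrite liftAbove-< (ℕₚ.≰⇒> a≰y) | liftAbove-< (ℕₚ.≰⇒> a≰z) = y<z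

liftAbove-≢ : ∀ a y → liftAbove a y ≢ a
liftAbove-≢ a y with a ℕₚ.≤? y
... | yes a≤y rewrite liftAbove-≥ a≤y = ℕₚ.>⇒≢ (s≤s a≤y)
... | no a≰y rewrite liftAbove-< (ℕₚ.≰⇒> a≰y) = ℕₚ.<⇒≢ (ℕₚ.≰⇒> a≰y)

lowerAbove-> : ∀ {x y} → x < y → lowerAbove x y ≡ y ∸ 1
lowerAbove-> x<y rewrite <ᵇ-true x<y = refl

lowerAbove-≤ : ∀ {x y} → y ≤ x → lowerAbove x y ≡ y
lowerAbove-≤ y≤x rewrite <ᵇ-false y≤x = refl

lowerAbove-mono : ∀ x {y z} → y ≢ x → y < z → lowerAbove x y < lowerAbove x z
lowerAbove-mono x {y} {z} y≢x y<z with x ℕₚ.<? y | x ℕₚ.<? z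
... | yes x<y | _ rewrite lowerAbove-> x<y | lowerAbove-> (ℕₚ.<-trans x<y y<z) =
  ℕₚ.∸-monoˡ-< y<z (ℕₚ.≤-trans (s≤s z≤n) x<y)
... | no x≮y | yes x<z@(s≤s x≤z-1) rewrite lowerAbove-≤ (ℕₚ.≮⇒≥ x≮y) | lowerAbove-> x<z =
  ℕₚ.<-≤-trans (ℕₚ.≤∧≢⇒< (ℕₚ.≮⇒≥ x≮y) y≢x) x≤z-1
... | no x≮y | no x≮z rewrite lowerAbove-≤ (ℕₚ.≮⇒≥ x≮y) | lowerAbove-≤ (ℕₚ.≮⇒≥ x≮z) = y<z

Unique-insert : ∀ {A : Set} (P : List A) {a} Q → All (a ≢_) (P ++ Q) → Unique (P ++ Q) →
                Unique (P ++ a ∷ Q)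
Unique-insert []      Q a∉Q         uQ          = a∉Q ∷ uQ
Unique-insert (p ∷ P) Q (a≢p ∷ a∉) (p∉ ∷ uP++Q) =
  Allₚ.++⁺ (Allₚ.++⁻ˡ P p∉) ((a≢p ∘ sym) ∷ Allₚ.++⁻ʳ P p∉) ∷ Unique-insert P Q a∉ uP++Q

Unique-delete : ∀ {A : Set} (u : List A) {x} v → Unique (u ++ x ∷ v) →
                All (x ≢_) (u ++ v) × Unique (u ++ v)
Unique-delete []      v (x∉v ∷ uv)    = x∉v , uv
Unique-delete (w ∷ u) v (w∉ ∷ uu++x∷v) with Unique-delete u v uu++x∷v
... | x∉u++v , uu++v with Allₚ.++⁻ u w∉
...   | w∉u , w≢x ∷ w∉v = ((w≢x ∘ sym) ∷ x∉u++v) , (Allₚ.++⁺ w∉u w∉v ∷ uu++v)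

maxL-greatest : ∀ w → All (_≤ maxL w) w
maxL-greatest []      = []
maxL-greatest (y ∷ w) =
  ℕₚ.m≤m⊔n y (maxL w) ∷ All.map (λ z≤w → ℕₚ.≤-trans z≤w (ℕₚ.m≤n⊔m y (maxL w))) (maxL-greatest w)

maxL-least : ∀ {b} w → All (_≤ b) w → maxL w ≤ b
maxL-least []      []              = z≤n
maxL-least (y ∷ w) (y≤b ∷ w≤b)     = ℕₚ.⊔-lub y≤b (maxL-least w w≤b)

bar-++ : ∀ a u f v → bar a (u ++ f ++ v) ≡ bar a u ++ bar a f ++ bar a v
bar-++ a u f v =
  trans (Listₚ.map-++ (liftAbove a) u (f ++ v)) (cong (bar a u ++_) (Listₚ.map-++ (liftAbove a) f v))

bar-fixes-below : ∀ {a} w → All (_< a) w → bar a w ≡ w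
bar-fixes-below w w<a = Listₚ.map-id-local (All.map liftAbove-< w<a)

bar-above-max : ∀ u f v → bar (suc (maxL f)) (u ++ f ++ v) ≡ bar (suc (maxL f)) u ++ f ++ bar (suc (maxL f)) v
bar-above-max u f v =
  trans (bar-++ a u f v)
        (cong (λ w → bar a u ++ w ++ bar a v) (bar-fixes-below f (All.map s≤s (maxL-greatest f))))
  where
  a : ℕ
  a = suc (maxL f)

dropAbove-fixes-below : ∀ {x} w → All (_≤ x) w → dropAbove x w ≡ w
dropAbove-fixes-below w w≤x = Listₚ.map-id-local (All.map lowerAbove-≤ w≤x)

data StepEffect (σ ρ : List ℕ) : Set where
  grows   : length ρ ≡ suc (length σ) → des σ ≤ des ρ → StepEffect σ ρ
  shrinks : length σ ≡ suc (length ρ) → des σ ≤ suc (des ρ) → StepEffect σ ρ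

insertion-effect : ∀ a P Q {σ} → P ++ Q ≡ bar a σ → Unique σ →
                   Unique (P ++ a ∷ Q) × StepEffect σ (P ++ a ∷ Q)
insertion-effect a P Q {σ} P++Q≡barσ uσ =
    Unique-insert P Q (subst (All (a ≢_)) (sym P++Q≡barσ) a∉barσ)
                      (subst Unique (sym P++Q≡barσ) (Lift.unique-map all⊤ uσ))
  , grows (trans (Listₚ.length-++-sucʳ P a Q)
                 (cong suc (trans (cong length P++Q≡barσ) (Listₚ.length-map (liftAbove a) σ))))
          (begin
            des σ           ≡⟨ Lift.des-map σ all⊤ ⟨
            des (bar a σ)   ≡⟨ cong des P++Q≡barσ ⟨
            des (P ++ Q)    ≤⟨ des-insert P a Q ⟩
            des (P ++ a ∷ Q) ∎)
  where
  open ℕₚ.≤-Reasoning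
  module Lift = StrictlyMonotoneOn {λ _ → ⊤} (liftAbove a) (λ _ _ → liftAbove-mono a)
  all⊤ : All (λ _ → ⊤) σ
  all⊤ = All.universal (λ _ → tt) σ
  a∉barσ : All (a ≢_) (bar a σ)
  a∉barσ = Allₚ.map⁺ (All.universal (λ y → liftAbove-≢ a y ∘ sym) σ)

deletion-effect : ∀ u x v → Unique (u ++ x ∷ v) →
                  Unique (dropAbove x (u ++ v)) × StepEffect (u ++ x ∷ v) (dropAbove x (u ++ v))
deletion-effect u x v uσ =
    Lower.unique-map ≢x (proj₂ (Unique-delete u v uσ))
  , shrinks (trans (Listₚ.length-++-sucʳ u x v) (cong suc (sym (Listₚ.length-map (lowerAbove x) (u ++ v)))))
            (ℕₚ.≤-trans (des-delete u x v) (s≤s (ℕₚ.≤-reflexive (sym (Lower.des-map (u ++ v) ≢x)))))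
  where
  module Lower = StrictlyMonotoneOn {_≢ x} (lowerAbove x) (λ y≢x _ → lowerAbove-mono x y≢x)
  ≢x : All (_≢ x) (u ++ v)
  ≢x = All.map (_∘ sym) (proj₁ (Unique-delete u v uσ))

step-effect : ∀ {σ ρ} → Step σ ρ → Unique σ → Unique ρ × StepEffect σ ρ
step-effect (del u x v)         = deletion-effect u x v
step-effect ins∅                = insertion-effect 1 [] [] {[]} refl
step-effect (insA u y ys v _)   =
  insertion-effect (suc (maxL (y ∷ ys))) (bar _ u) (y ∷ ys ++ bar _ v) (sym (bar-above-max u (y ∷ ys) v))
step-effect (insR u y ys v _) uσ =
  subst (λ ρ → Unique ρ × StepEffect (u ++ (y ∷ ys) ++ v) ρ)
        (Listₚ.++-assoc (bar a u) (y ∷ ys) (a ∷ bar a v))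
    (insertion-effect a (bar a u ++ y ∷ ys) (bar a v)
      (trans (Listₚ.++-assoc (bar a u) (y ∷ ys) (bar a v)) (sym (bar-above-max u (y ∷ ys) v))) uσ)
  where
  a : ℕ
  a = suc (maxL (y ∷ ys))
step-effect (insL u y ys v _)   =
  insertion-effect m (bar m u) (bar m (y ∷ ys) ++ bar m v) (sym (bar-++ m u (y ∷ ys) v))
  where
  m : ℕ
  m = foldr ℕ._⊓_ y ys

Path-cast : ∀ {k k′ σ σ′ τ τ′} → k ≡ k′ → σ ≡ σ′ → τ ≡ τ′ → Path k σ τ → Path k′ σ′ τ′
Path-cast refl refl refl p = p

Path-++ : ∀ {k l σ ρ τ} → Path k σ ρ → Path l ρ τ → Path (k + l) σ τ
Path-++ here       q = q
Path-++ (step s p) q = step s (Path-++ p q)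

ascending : ℕ → ℕ → List ℕ
ascending n zero    = []
ascending n (suc m) = suc n ∷ ascending (suc n) m

ascending-suc : ∀ n m → ascending (suc n) m ≡ map suc (ascending n m)
ascending-suc n zero    = refl
ascending-suc n (suc m) = cong (suc (suc n) ∷_) (ascending-suc (suc n) m)

idPerm≡ascending : ∀ n → idPerm n ≡ ascending 0 n
idPerm≡ascending zero    = refl
idPerm≡ascending (suc n) = cong (1 ∷_) (begin
  map suc (applyUpTo suc n)     ≡⟨ cong (map suc) (Listₚ.map-upTo suc n) ⟨
  map suc (idPerm n)            ≡⟨ cong (map suc) (idPerm≡ascending n) ⟩
  map suc (ascending 0 n)       ≡⟨ ascending-suc 0 n ⟨
  ascending 1 n                 ∎)
  where open ≡.≡-Reasoning

desFrom-ascending : ∀ {x} n m → x ≤ n → desFrom x (ascending n m) ≡ 0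
desFrom-ascending n zero    x≤n = refl
desFrom-ascending n (suc m) x≤n rewrite descent-≥ (ℕₚ.m≤n⇒m≤1+n x≤n) =
  desFrom-ascending (suc n) m ℕₚ.≤-refl

des-idPerm : ∀ n → des (idPerm n) ≡ 0
des-idPerm n rewrite idPerm≡ascending n with n
... | zero  = refl
... | suc m = desFrom-ascending 1 m ℕₚ.≤-refl

length-idPerm : ∀ n → length (idPerm n) ≡ n
length-idPerm n = trans (Listₚ.length-map suc (upTo n)) (Listₚ.length-upTo n)

Letter : ℕ → ℕ → Set
Letter n y = 1 ≤ y × y ≤ n

∈-idPerm⁻ : ∀ {n x} → x ∈ idPerm n → Letter n x
∈-idPerm⁻ x∈ with ∈ₚ.∈-map⁻ suc x∈
... | i , i∈ , refl = s≤s z≤n , ∈ₚ.∈-upTo⁻ i∈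

∈-idPerm⁺ : ∀ {n x} → Letter n x → x ∈ idPerm n
∈-idPerm⁺ (s≤s {n = i} _ , i<n) = ∈ₚ.∈-map⁺ suc (∈ₚ.∈-upTo⁺ i<n)

maxL-idPerm : ∀ n → maxL (idPerm (suc n)) ≡ suc n
maxL-idPerm n = ℕₚ.≤-antisym
  (maxL-least (idPerm (suc n)) (All.tabulate (proj₂ ∘ ∈-idPerm⁻)))
  (All.lookup (maxL-greatest (idPerm (suc n))) (∈-idPerm⁺ (s≤s z≤n , ℕₚ.≤-refl)))

idPerm-snoc : ∀ n → idPerm (suc n) ≡ idPerm n ++ [ suc n ]
idPerm-snoc n = trans (cong (map suc) (sym (Listₚ.upTo-∷ʳ n))) (Listₚ.map-++ suc (upTo n) [ n ])

idPerm-complete : ∀ n → Complete [] (idPerm n) []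
idPerm-complete n =
  (1 , n , (λ _ → ∈-idPerm⁻) , (λ _ 1≤x x≤n → ∈-idPerm⁺ (1≤x , x≤n))) , no-extension
  where
  no-extension : ∀ g v′ → [] ≡ g ++ v′ → g ≢ [] →
                 Compact (idPerm n ++ g) → maxL (idPerm n ++ g) ≡ maxL (idPerm n) → ⊥
  no-extension []      _ _  g≢[] _ _ = g≢[] refl
  no-extension (_ ∷ _) _ () _    _ _

appendMax : ∀ n → Step (idPerm n) (idPerm (suc n))
appendMax zero    = ins∅
appendMax (suc n) =
  ≡.subst₂ Step (Listₚ.++-identityʳ (idPerm (suc n))) idPerm-extended
    (insR [] 1 (map suc (applyUpTo suc n)) [] (idPerm-complete (suc n)))
  where
  idPerm-extended : idPerm (suc n) ++ [ suc (maxL (idPerm (suc n))) ] ≡ idPerm (suc (suc n))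
  idPerm-extended = trans (cong (λ m → idPerm (suc n) ++ [ suc m ]) (maxL-idPerm n)) (sym (idPerm-snoc (suc n)))

dropAbove-ascending : ∀ {x n} m → x ≤ suc n → dropAbove x (ascending (suc n) m) ≡ ascending n m
dropAbove-ascending zero    _     = refl
dropAbove-ascending (suc m) x≤1+n =
  cong₂ _∷_ (lowerAbove-> (s≤s x≤1+n)) (dropAbove-ascending m (ℕₚ.m≤n⇒m≤1+n x≤1+n))

dropAbove-++-ascending : ∀ {n} w m → All (_≤ suc n) w →
                         dropAbove (suc n) (w ++ ascending (suc n) m) ≡ w ++ ascending n m
dropAbove-++-ascending w m w≤1+n = trans (Listₚ.map-++ (lowerAbove _) w _)
  (cong₂ _++_ (dropAbove-fixes-below w w≤1+n) (dropAbove-ascending m ℕₚ.≤-refl))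

unshift-letters : ∀ {n p J} → p ≤ n → All (p <_) J → All (Letter (n ∸ p)) (map (_∸ p) J) →
                  All (λ y → p < y × y ≤ n) J
unshift-letters {n} {p} p≤n J>p J-p-letters = All.zipWith bound (J>p , Allₚ.map⁻ J-p-letters)
  where
  bound : ∀ {y} → p < y × Letter (n ∸ p) (y ∸ p) → p < y × y ≤ n
  bound {y} (p<y , _ , y-p≤n-p) = p<y , (begin
    y            ≡⟨ ℕₚ.m∸n+n≡m (ℕₚ.<⇒≤ p<y) ⟨
    y ∸ p + p    ≤⟨ ℕₚ.+-monoˡ-≤ p y-p≤n-p ⟩
    n ∸ p + p    ≡⟨ ℕₚ.m∸n+n≡m p≤n ⟩
    n            ∎)
    where open ℕₚ.≤-Reasoning

OneStack-letters : ∀ {n σ} → OneStack n σ → All (Letter n) σ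
OneStack-letters os-empty = []
OneStack-letters {suc n} (os-split p I J p≤n osI J>p osJ) =
  Allₚ.++⁺ (All.map (λ (1≤y , y≤p) → 1≤y , ℕₚ.m≤n⇒m≤1+n (ℕₚ.≤-trans y≤p p≤n)) (OneStack-letters osI))
           ((s≤s z≤n , ℕₚ.≤-refl)
            ∷ All.map (λ (p<y , y≤n) → ℕₚ.≤-trans (s≤s z≤n) p<y , ℕₚ.m≤n⇒m≤1+n y≤n)
                      (unshift-letters p≤n J>p (OneStack-letters osJ)))

OneStack-length : ∀ {n σ} → OneStack n σ → length σ ≡ n
OneStack-length os-empty = refl
OneStack-length {suc n} (os-split p I J p≤n osI J>p osJ) = begin
  length (I ++ suc n ∷ J)            ≡⟨ Listₚ.length-++-sucʳ I (suc n) J ⟩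
  suc (length (I ++ J))              ≡⟨ cong suc (Listₚ.length-++ I) ⟩
  suc (length I + length J)          ≡⟨ cong (λ l → suc (length I + l)) (Listₚ.length-map (_∸ p) J) ⟨
  suc (length I + length (map (_∸ p) J))
                                     ≡⟨ cong₂ (λ a b → suc (a + b)) (OneStack-length osI) (OneStack-length osJ) ⟩
  suc (p + (n ∸ p))                  ≡⟨ cong suc (ℕₚ.m+[n∸m]≡n p≤n) ⟩
  suc n                              ∎
  where open ≡.≡-Reasoning

OneStack-unique : ∀ {n σ} → OneStack n σ → Unique σ
OneStack-unique os-empty = []
OneStack-unique {suc n} (os-split p I J p≤n osI J>p osJ) =
  UniqueP.++⁺ (OneStack-unique osI) (n+1∉J ∷ UniqueP.map⁻ (OneStack-unique osJ)) disjoint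
  where
  I≤p : All (_≤ p) I
  I≤p = All.map proj₂ (OneStack-letters osI)
  J-bounds : All (λ y → p < y × y ≤ n) J
  J-bounds = unshift-letters p≤n J>p (OneStack-letters osJ)
  n+1∉J : All (suc n ≢_) J
  n+1∉J = All.map (λ (_ , y≤n) → ℕₚ.>⇒≢ (s≤s y≤n)) J-bounds
  disjoint : ∀ {y} → ¬ (y ∈ I × y ∈ suc n ∷ J)
  disjoint (y∈I , here refl) = ℕₚ.<-irrefl refl (s≤s (ℕₚ.≤-trans (All.lookup I≤p y∈I) p≤n))
  disjoint (y∈I , there y∈J) =
    ℕₚ.<-irrefl refl (ℕₚ.≤-<-trans (All.lookup I≤p y∈I) (proj₁ (All.lookup J-bounds y∈J)))

OneStack-[]⇒0 : ∀ {n σ} → OneStack n σ → σ ≡ [] → n ≡ 0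
OneStack-[]⇒0 os-empty                     _  = refl
OneStack-[]⇒0 (os-split _ I J _ _ _ _) I++n∷J≡[] with Listₚ.++-conicalʳ I (_ ∷ J) I++n∷J≡[]
... | ()

map-∸-+ : ∀ p J → map (_∸ p) (map (p +_) J) ≡ J
map-∸-+ p J = trans (sym (Listₚ.map-∘ J)) (trans (Listₚ.map-cong (ℕₚ.m+n∸m≡n p) J) (Listₚ.map-id J))

map-+-∸ : ∀ {p J} → All (p <_) J → map (p +_) (map (_∸ p) J) ≡ J
map-+-∸ {p} {J} J>p =
  trans (sym (Listₚ.map-∘ J)) (Listₚ.map-id-local (All.map (ℕₚ.m+[n∸m]≡n ∘ ℕₚ.<⇒≤) J>p))

OneStack-⊕ : ∀ {p m I K} → OneStack p I → OneStack m K → OneStack (p + m) (I ++ map (p +_) K)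
OneStack-⊕ {p} {I = I} osI os-empty =
  ≡.subst₂ OneStack (sym (ℕₚ.+-identityʳ p)) (sym (Listₚ.++-identityʳ I)) osI
OneStack-⊕ {p} {suc m} {I} osI (os-split q I₂ J₂ q≤m osI₂ J₂>q osJ₂) =
  ≡.subst₂ OneStack (sym (ℕₚ.+-suc p m)) rearrange
    (os-split (p + q) (I ++ map (p +_) I₂) (map (p +_) J₂) (ℕₚ.+-monoʳ-≤ p q≤m) (OneStack-⊕ osI osI₂)
      (Allₚ.map⁺ (All.map (ℕₚ.+-monoʳ-< p) J₂>q))
      (≡.subst₂ OneStack (sym (ℕₚ.[m+n]∸[m+o]≡n∸o p m q)) shift osJ₂))
  where
  shift : map (_∸ q) J₂ ≡ map (_∸ (p + q)) (map (p +_) J₂)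
  shift = trans (Listₚ.map-cong (λ y → sym (ℕₚ.[m+n]∸[m+o]≡n∸o p y q)) J₂) (Listₚ.map-∘ J₂)
  rearrange : (I ++ map (p +_) I₂) ++ suc (p + m) ∷ map (p +_) J₂ ≡ I ++ map (p +_) (I₂ ++ suc m ∷ J₂)
  rearrange = begin
    (I ++ map (p +_) I₂) ++ suc (p + m) ∷ map (p +_) J₂
      ≡⟨ Listₚ.++-assoc I _ _ ⟩
    I ++ map (p +_) I₂ ++ suc (p + m) ∷ map (p +_) J₂
      ≡⟨ cong (λ x → I ++ map (p +_) I₂ ++ x ∷ map (p +_) J₂) (ℕₚ.+-suc p m) ⟨
    I ++ map (p +_) I₂ ++ map (p +_) (suc m ∷ J₂)
      ≡⟨ cong (I ++_) (Listₚ.map-++ (p +_) I₂ _) ⟨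
    I ++ map (p +_) (I₂ ++ suc m ∷ J₂) ∎
    where open ≡.≡-Reasoning

OneStack-deleteMax : ∀ {n p I J} → p ≤ n → OneStack p I → All (p <_) J → OneStack (n ∸ p) (map (_∸ p) J) →
                     OneStack n (I ++ J)
OneStack-deleteMax {n} {p} {I} p≤n osI J>p osJ =
  ≡.subst₂ OneStack (ℕₚ.m+[n∸m]≡n p≤n) (cong (I ++_) (map-+-∸ J>p)) (OneStack-⊕ osI osJ)

-- The distance to the identity

path-lowerBound : ∀ n {k σ} → Path k σ (idPerm n) → Unique σ → twiceDes σ + n ≤ k + length σ
path-lowerBound n here _ rewrite des-idPerm n | length-idPerm n = ℕₚ.≤-refl
path-lowerBound n {suc k} {σ} (step {ρ = ρ} s p) uσ with step-effect s uσ
... | uρ , grows len des≤ = begin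
  des σ + des σ + n  ≤⟨ ℕₚ.+-monoˡ-≤ n (ℕₚ.+-mono-≤ des≤ des≤) ⟩
  des ρ + des ρ + n  ≤⟨ path-lowerBound n p uρ ⟩
  k + length ρ       ≡⟨ trans (cong (k +_) len) (ℕₚ.+-suc k (length σ)) ⟩
  suc k + length σ   ∎
  where open ℕₚ.≤-Reasoning
... | uρ , shrinks len des≤ = begin
  des σ + des σ + n                    ≤⟨ ℕₚ.+-monoˡ-≤ n (ℕₚ.+-mono-≤ des≤ des≤) ⟩
  suc (des ρ) + suc (des ρ) + n        ≡⟨ cong (λ m → suc m + n) (ℕₚ.+-suc (des ρ) (des ρ)) ⟩
  suc (suc (des ρ + des ρ + n))        ≤⟨ s≤s (s≤s (path-lowerBound n p uρ)) ⟩
  suc (suc (k + length ρ))             ≡⟨ cong suc (ℕₚ.+-suc k (length ρ)) ⟨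
  suc k + suc (length ρ)               ≡⟨ cong (suc k +_) len ⟨
  suc k + length σ                     ∎
  where open ℕₚ.≤-Reasoning

-- The suffix ascending n m of larger letters lets the case J = [] recurse on I:
-- I (n+1) followed by ascending (n+1) m is I followed by ascending n (m+1).
path-upperBound : ∀ n {σ} → OneStack n σ → ∀ m → Path (twiceDes σ) (σ ++ ascending n m) (idPerm (n + m))
path-upperBound zero os-empty m = Path-cast refl refl (sym (idPerm≡ascending m)) here
path-upperBound (suc n) (os-split p I [] p≤n osI _ osJ) m
  with refl ← ℕₚ.≤-antisym p≤n (ℕₚ.m∸n≡0⇒m≤n (OneStack-[]⇒0 osJ refl)) =
  Path-cast (cong (λ d → d + d) (sym (des-++-larger I I<n+1))) (sym (Listₚ.++-assoc I [ suc n ] _))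
            (cong idPerm (ℕₚ.+-suc n m))
    (path-upperBound n osI (suc m))
  where
  I<n+1 : All (_< suc n) I
  I<n+1 = All.map (s≤s ∘ proj₂) (OneStack-letters osI)
path-upperBound (suc n) (os-split p I (j ∷ J) p≤n osI J>p osJ) m =
  Path-cast length-eq (sym (Listₚ.++-assoc I (suc n ∷ j ∷ J) _)) refl
    (step (del I (suc n) ((j ∷ J) ++ ascending (suc n) m))
      (Path-cast refl (sym drop-eq) refl
        (Path-++ (path-upperBound n osIJ m) (step (appendMax (n + m)) here))))
  where
  osIJ : OneStack n (I ++ j ∷ J)
  osIJ = OneStack-deleteMax p≤n osI J>p osJ
  D : ℕ
  D = des (I ++ j ∷ J)
  j≤n : j ≤ n
  j≤n = All.lookup (All.map proj₂ (OneStack-letters osIJ)) (∈ₚ.∈-++⁺ʳ I (here refl))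
  des-σ : des (I ++ suc n ∷ j ∷ J) ≡ suc D
  des-σ = des-remove-peak I J (All.map (λ (_ , y≤p) → ℕₚ.≤-<-trans y≤p (All.head J>p)) (OneStack-letters osI))
                              (s≤s j≤n)
  length-eq : suc (D + D + 1) ≡ twiceDes (I ++ suc n ∷ j ∷ J)
  length-eq = trans (cong suc (trans (ℕₚ.+-comm (D + D) 1) (sym (ℕₚ.+-suc D D))))
                    (sym (cong (λ d → d + d) des-σ))
  drop-eq : dropAbove (suc n) (I ++ (j ∷ J) ++ ascending (suc n) m) ≡ (I ++ j ∷ J) ++ ascending n m
  drop-eq = trans (cong (dropAbove (suc n)) (sym (Listₚ.++-assoc I (j ∷ J) _)))
                  (dropAbove-++-ascending (I ++ j ∷ J) m
                    (All.map (ℕₚ.m≤n⇒m≤1+n ∘ proj₂) (OneStack-letters osIJ)))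

OneStack-distance : ∀ {n σ} → OneStack n σ → Dist σ (idPerm n) (twiceDes σ)
OneStack-distance {n} {σ} osσ =
  Path-cast refl (Listₚ.++-identityʳ σ) (cong idPerm (ℕₚ.+-identityʳ n)) (path-upperBound n osσ 0) , minimal
  where
  minimal : ∀ j → Path j σ (idPerm n) → twiceDes σ ≤ j
  minimal j p = ℕₚ.+-cancelʳ-≤ n _ _ (ℕₚ.≤-trans (path-lowerBound n p (OneStack-unique osσ))
                                                 (ℕₚ.≤-reflexive (cong (j +_) (OneStack-length osσ))))

Dist-unique : ∀ {σ τ k k′} → Dist σ τ k → Dist σ τ k′ → k ≡ k′
Dist-unique (p , min) (p′ , min′) = ℕₚ.≤-antisym (min _ p′) (min′ _ p)

-- Enumerating one-stack sortable permutations

++-∷-injective : ∀ {A : Set} {x : A} I {J} I′ {J′} → All (x ≢_) I → All (x ≢_) I′ →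
                 I ++ x ∷ J ≡ I′ ++ x ∷ J′ → I ≡ I′ × J ≡ J′
++-∷-injective []      []        _         _          eq = refl , Listₚ.∷-injectiveʳ eq
++-∷-injective []      (y ∷ I′)  _         (x≢y ∷ _)  eq = contradiction (Listₚ.∷-injectiveˡ eq) x≢y
++-∷-injective (y ∷ I) []        (x≢y ∷ _) _          eq = contradiction (Listₚ.∷-injectiveˡ eq) (x≢y ∘ sym)
++-∷-injective (y ∷ I) (y′ ∷ I′) (_ ∷ x∉I) (_ ∷ x∉I′) eq with Listₚ.∷-injective eq
... | refl , eq′ = Product.map₁ (cong (y ∷_)) (++-∷-injective I I′ x∉I x∉I′ eq′)

module _ {A B : Set} (g : A → List B) where

  ∈-concatMap⁻ : ∀ xs {z} → z ∈ concatMap g xs → ∃ λ x → x ∈ xs × z ∈ g x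
  ∈-concatMap⁻ xs z∈ = find (∈ₚ.∈-concatMap⁻ g z∈)

  ∈-concatMap⁺ : ∀ {xs x z} → x ∈ xs → z ∈ g x → z ∈ concatMap g xs
  ∈-concatMap⁺ x∈ z∈ = ∈ₚ.∈-concatMap⁺ g (lose x∈ z∈)

  Unique-concatMap⁺ : ∀ {xs} → Unique xs → (∀ {x} → x ∈ xs → Unique (g x)) →
                      (∀ {x x′ z} → x ∈ xs → x′ ∈ xs → z ∈ g x → z ∈ g x′ → x ≡ x′) →
                      Unique (concatMap g xs)
  Unique-concatMap⁺ {[]}     _            _        _        = []
  Unique-concatMap⁺ {x ∷ xs} (x∉xs ∷ uxs) unique-g disjoint =
    UniqueP.++⁺ (unique-g (here refl))
                (Unique-concatMap⁺ uxs (unique-g ∘ there) (λ x∈ x′∈ → disjoint (there x∈) (there x′∈)))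
                separated
    where
    separated : ∀ {z} → ¬ (z ∈ g x × z ∈ concatMap g xs)
    separated (z∈gx , z∈rest) with ∈-concatMap⁻ xs z∈rest
    ... | x′ , x′∈xs , z∈gx′ =
      All.lookup x∉xs x′∈xs (disjoint (here refl) (there x′∈xs) z∈gx z∈gx′)

∈-insertAll⁻ : ∀ x τ {z} → z ∈ insertAll x τ → ∃₂ λ I J → τ ≡ I ++ J × z ≡ I ++ x ∷ J
∈-insertAll⁻ x []       (here refl) = [] , [] , refl , refl
∈-insertAll⁻ x (y ∷ ys) (here refl) = [] , y ∷ ys , refl , refl
∈-insertAll⁻ x (y ∷ ys) (there z∈) with ∈ₚ.∈-map⁻ (y ∷_) z∈
... | w , w∈ , refl with ∈-insertAll⁻ x ys w∈
...   | I , J , refl , refl = y ∷ I , J , refl , refl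

∈-insertAll⁺ : ∀ x I J → I ++ x ∷ J ∈ insertAll x (I ++ J)
∈-insertAll⁺ x []      []      = here refl
∈-insertAll⁺ x []      (y ∷ J) = here refl
∈-insertAll⁺ x (y ∷ I) J       = there (∈ₚ.∈-map⁺ (y ∷_) (∈-insertAll⁺ x I J))

insertAll-unique : ∀ x τ → All (x ≢_) τ → Unique (insertAll x τ)
insertAll-unique x []       _          = [] ∷ []
insertAll-unique x (y ∷ ys) (x≢y ∷ x∉ys) =
  Allₚ.map⁺ (All.universal (λ _ eq → x≢y (Listₚ.∷-injectiveˡ eq)) (insertAll x ys))
  ∷ UniqueP.map⁺ Listₚ.∷-injectiveʳ (insertAll-unique x ys x∉ys)

insertAll-disjoint : ∀ x {τ τ′ z} → All (x ≢_) τ → All (x ≢_) τ′ →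
                     z ∈ insertAll x τ → z ∈ insertAll x τ′ → τ ≡ τ′
insertAll-disjoint x x∉τ x∉τ′ z∈ z∈′ with ∈-insertAll⁻ x _ z∈ | ∈-insertAll⁻ x _ z∈′
... | I , J , refl , refl | I′ , J′ , refl , z≡
  with ++-∷-injective I I′ (Allₚ.++⁻ˡ I x∉τ) (Allₚ.++⁻ˡ I′ x∉τ′) z≡
... | refl , refl = refl

perms-letters : ∀ n {σ} → σ ∈ perms n → All (_≤ n) σ
perms-letters zero    (here refl) = []
perms-letters (suc n) σ∈ with ∈-concatMap⁻ (insertAll (suc n)) (perms n) σ∈
... | τ , τ∈ , σ∈′ with ∈-insertAll⁻ (suc n) τ σ∈′
...   | I , J , refl , refl with Allₚ.++⁻ I (All.map ℕₚ.m≤n⇒m≤1+n (perms-letters n τ∈))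
...     | I≤ , J≤ = Allₚ.++⁺ I≤ (ℕₚ.≤-refl ∷ J≤)

perms-unique : ∀ n → Unique (perms n)
perms-unique zero    = [] ∷ []
perms-unique (suc n) = Unique-concatMap⁺ (insertAll (suc n)) (perms-unique n)
  (λ τ∈ → insertAll-unique (suc n) _ (fresh τ∈))
  (λ τ∈ τ′∈ → insertAll-disjoint (suc n) (fresh τ∈) (fresh τ′∈))
  where
  fresh : ∀ {τ} → τ ∈ perms n → All (suc n ≢_) τ
  fresh τ∈ = All.map (λ y≤n → ℕₚ.>⇒≢ (s≤s y≤n)) (perms-letters n τ∈)

OneStack⇒∈perms : ∀ {n σ} → OneStack n σ → σ ∈ perms n
OneStack⇒∈perms os-empty = here refl
OneStack⇒∈perms (os-split p I J p≤n osI J>p osJ) =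
  ∈-concatMap⁺ (insertAll _) (OneStack⇒∈perms (OneStack-deleteMax p≤n osI J>p osJ)) (∈-insertAll⁺ _ I J)

withMax : ℕ → ℕ → List ℕ → List ℕ → List ℕ
withMax n p I J = I ++ suc n ∷ map (p +_) J

withMaxAll : (ℕ → List (List ℕ)) → ℕ → ℕ → List (List ℕ)
withMaxAll L n p = concatMap (λ I → map (withMax n p I) (L (n ∸ p))) (L p)

-- The first argument is fuel for the recursion on p and n ∸ p; any fuel ≥ n gives the same list.
oneStackPerms′ : ℕ → ℕ → List (List ℕ)
oneStackPerms′ _       zero    = [] ∷ []
oneStackPerms′ zero    (suc n) = []
oneStackPerms′ (suc f) (suc n) = concatMap (withMaxAll (oneStackPerms′ f) n) (upTo (suc n))

oneStackPerms : ℕ → List (List ℕ)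
oneStackPerms n = oneStackPerms′ n n

∈-withMaxAll⁻ : ∀ L n p {z} → z ∈ withMaxAll L n p →
                ∃₂ λ I J → I ∈ L p × J ∈ L (n ∸ p) × z ≡ withMax n p I J
∈-withMaxAll⁻ L n p z∈ with ∈-concatMap⁻ _ (L p) z∈
... | I , I∈ , z∈′ with ∈ₚ.∈-map⁻ (withMax n p I) z∈′
...   | J , J∈ , z≡ = I , J , I∈ , J∈ , z≡

∈-withMaxAll⁺ : ∀ L n p {I J} → I ∈ L p → J ∈ L (n ∸ p) → withMax n p I J ∈ withMaxAll L n p
∈-withMaxAll⁺ L n p I∈ J∈ = ∈-concatMap⁺ _ I∈ (∈ₚ.∈-map⁺ (withMax n p _) J∈)

OneStack-withMax : ∀ {n p I J} → p ≤ n → OneStack p I → OneStack (n ∸ p) J →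
                   OneStack (suc n) (withMax n p I J)
OneStack-withMax {n} {p} {I} {J} p≤n osI osJ =
  os-split p I (map (p +_) J) p≤n osI
    (Allₚ.map⁺ (All.map (ℕₚ.m<m+n p ∘ proj₁) (OneStack-letters osJ)))
    (subst (OneStack (n ∸ p)) (sym (map-∸-+ p J)) osJ)

∈-oneStackPerms′⁻ : ∀ f n {σ} → σ ∈ oneStackPerms′ f n → OneStack n σ
∈-oneStackPerms′⁻ _       zero    (here refl) = os-empty
∈-oneStackPerms′⁻ (suc f) (suc n) σ∈ with ∈-concatMap⁻ _ (upTo (suc n)) σ∈
... | p , p∈ , σ∈′ with ∈-withMaxAll⁻ (oneStackPerms′ f) n p σ∈′
...   | I , J , I∈ , J∈ , refl =
  OneStack-withMax (ℕₚ.≤-pred (∈ₚ.∈-upTo⁻ p∈)) (∈-oneStackPerms′⁻ f p I∈)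
                                                 (∈-oneStackPerms′⁻ f (n ∸ p) J∈)

∈-oneStackPerms′⁺ : ∀ f {n σ} → n ≤ f → OneStack n σ → σ ∈ oneStackPerms′ f n
∈-oneStackPerms′⁺ _       _         os-empty = here refl
∈-oneStackPerms′⁺ (suc f) (s≤s n≤f) (os-split {n} p I J p≤n osI J>p osJ) =
  ∈-concatMap⁺ _ (∈ₚ.∈-upTo⁺ (s≤s p≤n))
    (subst (λ J′ → I ++ suc n ∷ J′ ∈ withMaxAll (oneStackPerms′ f) n p) (map-+-∸ J>p)
      (∈-withMaxAll⁺ (oneStackPerms′ f) n p (∈-oneStackPerms′⁺ f (ℕₚ.≤-trans p≤n n≤f) osI)
                                            (∈-oneStackPerms′⁺ f (ℕₚ.≤-trans (ℕₚ.m∸n≤m n p) n≤f) osJ)))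

withMax-injectiveˡ : ∀ {n p p′ I I′ J J′} → All (_≤ n) I → All (_≤ n) I′ →
                     withMax n p I J ≡ withMax n p′ I′ J′ → I ≡ I′
withMax-injectiveˡ {n} I≤n I′≤n eq = proj₁ (++-∷-injective _ _ (fresh I≤n) (fresh I′≤n) eq)
  where
  fresh : ∀ {I} → All (_≤ n) I → All (suc n ≢_) I
  fresh = All.map (λ y≤n → ℕₚ.>⇒≢ (s≤s y≤n))

withMax-injectiveʳ : ∀ {n p I J J′} → withMax n p I J ≡ withMax n p I J′ → J ≡ J′
withMax-injectiveʳ {p = p} eq =
  Listₚ.map-injective (ℕₚ.+-cancelˡ-≡ p _ _) (Listₚ.∷-injectiveʳ (Listₚ.++-cancelˡ _ _ _ eq))

oneStackPerms′-unique : ∀ f n → Unique (oneStackPerms′ f n)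
oneStackPerms′-unique _       zero    = [] ∷ []
oneStackPerms′-unique zero    (suc n) = []
oneStackPerms′-unique (suc f) (suc n) =
  Unique-concatMap⁺ (withMaxAll L n) (UniqueP.upTo⁺ (suc n))
                    (withMaxAll-unique ∘ ℕₚ.≤-pred ∘ ∈ₚ.∈-upTo⁻) same-p
  where
  L : ℕ → List (List ℕ)
  L = oneStackPerms′ f
  prefix≤n : ∀ {p I} → p ≤ n → I ∈ L p → All (_≤ n) I
  prefix≤n p≤n I∈ = All.map (λ (_ , y≤p) → ℕₚ.≤-trans y≤p p≤n) (OneStack-letters (∈-oneStackPerms′⁻ f _ I∈))
  withMaxAll-unique : ∀ {p} → p ≤ n → Unique (withMaxAll L n p)
  withMaxAll-unique {p} p≤n = Unique-concatMap⁺ _ (oneStackPerms′-unique f p)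
    (λ _ → UniqueP.map⁺ withMax-injectiveʳ (oneStackPerms′-unique f (n ∸ p))) same-I
    where
    same-I : ∀ {I I′ z} → I ∈ L p → I′ ∈ L p → z ∈ map (withMax n p I) (L (n ∸ p)) →
             z ∈ map (withMax n p I′) (L (n ∸ p)) → I ≡ I′
    same-I I∈ I′∈ z∈ z∈′ with ∈ₚ.∈-map⁻ _ z∈ | ∈ₚ.∈-map⁻ _ z∈′
    ... | _ , _ , refl | _ , _ , eq = withMax-injectiveˡ (prefix≤n p≤n I∈) (prefix≤n p≤n I′∈) eq
  same-p : ∀ {p p′ z} → p ∈ upTo (suc n) → p′ ∈ upTo (suc n) →
           z ∈ withMaxAll L n p → z ∈ withMaxAll L n p′ → p ≡ p′
  same-p {p} {p′} p∈ p′∈ z∈ z∈′ with ∈-withMaxAll⁻ L n p z∈ | ∈-withMaxAll⁻ L n p′ z∈′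
  ... | I , J , I∈ , J∈ , refl | I′ , J′ , I′∈ , J′∈ , eq
    with withMax-injectiveˡ (prefix≤n (ℕₚ.≤-pred (∈ₚ.∈-upTo⁻ p∈)) I∈)
                            (prefix≤n (ℕₚ.≤-pred (∈ₚ.∈-upTo⁻ p′∈)) I′∈) eq
  ... | refl = trans (sym (OneStack-length (∈-oneStackPerms′⁻ f p I∈)))
                     (OneStack-length (∈-oneStackPerms′⁻ f p′ I′∈))

concatMap-cong-upTo : ∀ {A : Set} {g h : ℕ → List A} n → (∀ {p} → p ≤ n → g p ≡ h p) →
                      concatMap g (upTo (suc n)) ≡ concatMap h (upTo (suc n))
concatMap-cong-upTo n g≡h = cong concat
  (Listₚ.map-cong-local (All.tabulate (λ p∈ → g≡h (ℕₚ.≤-pred (∈ₚ.∈-upTo⁻ p∈)))))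

withMaxAll-cong : ∀ L L′ n p → L p ≡ L′ p → L (n ∸ p) ≡ L′ (n ∸ p) →
                  withMaxAll L n p ≡ withMaxAll L′ n p
withMaxAll-cong L L′ n p = cong₂ (λ A B → concatMap (λ I → map (withMax n p I) B) A)

oneStackPerms′-fuel : ∀ f {g n} → n ≤ f → n ≤ g → oneStackPerms′ f n ≡ oneStackPerms′ g n
oneStackPerms′-fuel _       {n = zero}          _         _         = refl
oneStackPerms′-fuel (suc f) {suc g} {suc n} (s≤s n≤f) (s≤s n≤g) = concatMap-cong-upTo n (λ {p} p≤n →
  withMaxAll-cong (oneStackPerms′ f) (oneStackPerms′ g) n p
    (oneStackPerms′-fuel f (ℕₚ.≤-trans p≤n n≤f) (ℕₚ.≤-trans p≤n n≤g))
    (oneStackPerms′-fuel f (ℕₚ.≤-trans (ℕₚ.m∸n≤m n p) n≤f) (ℕₚ.≤-trans (ℕₚ.m∸n≤m n p) n≤g)))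

oneStackPerms-suc : ∀ n → oneStackPerms (suc n) ≡ concatMap (withMaxAll oneStackPerms n) (upTo (suc n))
oneStackPerms-suc n = concatMap-cong-upTo n (λ {p} p≤n →
  withMaxAll-cong (oneStackPerms′ n) oneStackPerms n p
    (oneStackPerms′-fuel n p≤n ℕₚ.≤-refl) (oneStackPerms′-fuel n (ℕₚ.m∸n≤m n p) ℕₚ.≤-refl))

∈-oneStackPerms⁻ : ∀ {n σ} → σ ∈ oneStackPerms n → OneStack n σ
∈-oneStackPerms⁻ {n} = ∈-oneStackPerms′⁻ n n

∈-oneStackPerms⁺ : ∀ {n σ} → OneStack n σ → σ ∈ oneStackPerms n
∈-oneStackPerms⁺ {n} = ∈-oneStackPerms′⁺ n ℕₚ.≤-refl

oneStackPerms-unique : ∀ n → Unique (oneStackPerms n)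
oneStackPerms-unique n = oneStackPerms′-unique n n

sum-map-zero : ∀ {A : Set} {f : A → ℕ} xs → (∀ {x} → x ∈ xs → f x ≡ 0) → sum (map f xs) ≡ 0
sum-map-zero []       _    = refl
sum-map-zero (x ∷ xs) f≡0 = cong₂ _+_ (f≡0 (here refl)) (sum-map-zero xs (f≡0 ∘ there))

sum-map-cong : ∀ {A : Set} {f g : A → ℕ} xs → (∀ {x} → x ∈ xs → f x ≡ g x) → sum (map f xs) ≡ sum (map g xs)
sum-map-cong xs f≡g = cong sum (Listₚ.map-cong-local (All.tabulate f≡g))

sum-map-+ : ∀ {A : Set} (f g : A → ℕ) xs → sum (map (λ x → f x + g x) xs) ≡ sum (map f xs) + sum (map g xs)
sum-map-+ f g []       = refl
sum-map-+ f g (x ∷ xs) = trans (cong (f x + g x +_) (sum-map-+ f g xs)) (+-interchange (f x) (g x) _ _)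
  where
  open import Algebra.Properties.CommutativeSemigroup ℕₚ.+-commutativeSemigroup
    renaming (interchange to +-interchange)

sum-map-concatMap : ∀ {A B : Set} (h : B → ℕ) (g : A → List B) xs →
                    sum (map h (concatMap g xs)) ≡ sum (map (λ x → sum (map h (g x))) xs)
sum-map-concatMap h g []       = refl
sum-map-concatMap h g (x ∷ xs) = begin
  sum (map h (g x ++ concatMap g xs))               ≡⟨ cong sum (Listₚ.map-++ h (g x) _) ⟩
  sum (map h (g x) ++ map h (concatMap g xs))       ≡⟨ sum-++ (map h (g x)) _ ⟩
  sum (map h (g x)) + sum (map h (concatMap g xs))  ≡⟨ cong (sum (map h (g x)) +_) (sum-map-concatMap h g xs) ⟩
  sum (map h (g x)) + sum (map (λ x → sum (map h (g x))) xs) ∎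
  where open ≡.≡-Reasoning

sum-map-upTo : ∀ n (h : ℕ → ℕ) → sum (map h (upTo (suc n))) ≡ ℕΣ.sumTo n h
sum-map-upTo zero    h = ℕₚ.+-identityʳ (h 0)
sum-map-upTo (suc n) h = begin
  sum (map h (upTo (suc (suc n))))              ≡⟨ cong (sum ∘ map h) (Listₚ.upTo-∷ʳ (suc n)) ⟨
  sum (map h (upTo (suc n) ++ [ suc n ]))       ≡⟨ cong sum (Listₚ.map-++ h (upTo (suc n)) _) ⟩
  sum (map h (upTo (suc n)) ++ [ h (suc n) ])   ≡⟨ sum-++ (map h (upTo (suc n))) _ ⟩
  sum (map h (upTo (suc n))) + (h (suc n) + 0)  ≡⟨ cong₂ _+_ (sum-map-upTo n h) (ℕₚ.+-identityʳ (h (suc n))) ⟩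
  ℕΣ.sumTo n h + h (suc n)                      ∎
  where open ≡.≡-Reasoning

CountIs-sum : ∀ {A : Set} {P : A → Set} (P? : ∀ x → Dec (P x)) xs → CountIs P xs (sum (map (indicator ∘ P?) xs))
CountIs-sum P? []       = cnt-nil
CountIs-sum P? (x ∷ xs) with P? x
... | yes px = cnt-yes px (CountIs-sum P? xs)
... | no ¬px = cnt-no ¬px (CountIs-sum P? xs)

CountIs-resp : ∀ {A : Set} {P Q : A → Set} {xs m} → (∀ {x} → P x → Q x) → (∀ {x} → Q x → P x) →
               CountIs P xs m → CountIs Q xs m
CountIs-resp P⇒Q Q⇒P cnt-nil        = cnt-nil
CountIs-resp P⇒Q Q⇒P (cnt-yes px c) = cnt-yes (P⇒Q px) (CountIs-resp P⇒Q Q⇒P c)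
CountIs-resp P⇒Q Q⇒P (cnt-no ¬px c) = cnt-no (¬px ∘ Q⇒P) (CountIs-resp P⇒Q Q⇒P c)

indicator-× : ∀ {p q} {P : Set p} {Q : Set q} (P? : Dec P) (Q? : Dec Q) →
              indicator (P? ×-dec Q?) ≡ indicator P? * indicator Q?
indicator-× (yes _) (yes _) = refl
indicator-× (yes _) (no _)  = refl
indicator-× (no _)  (yes _) = refl
indicator-× (no _)  (no _)  = refl

_≟ₗ_ : DecidableEquality (List ℕ)
_≟ₗ_ = Listₚ.≡-dec ℕₚ._≟_

sum-indicator-≡ : ∀ (w : List ℕ → ℕ) {xs y} → Unique xs → y ∈ xs →
                  sum (map (λ x → indicator (x ≟ₗ y) * w x) xs) ≡ w y
sum-indicator-≡ w {x ∷ xs} (x∉xs ∷ _) (here refl) rewrite indicator-yes (x ≟ₗ x) refl =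
  trans (cong ((w x + 0) +_) (sum-map-zero xs (λ x′∈ →
          cong (_* w _) (indicator-no (_ ≟ₗ x) (All.lookup x∉xs x′∈ ∘ sym)))))
        (trans (ℕₚ.+-identityʳ _) (ℕₚ.+-identityʳ _))
sum-indicator-≡ w {x ∷ xs} {y} (x∉xs ∷ uxs) (there y∈xs) rewrite indicator-no (x ≟ₗ y) (All.lookup x∉xs y∈xs) =
  sum-indicator-≡ w uxs y∈xs

indicator-∈-∷ : ∀ x {y ys} → All (y ≢_) ys → indicator (x ∈? y ∷ ys) ≡ indicator (x ≟ₗ y) + indicator (x ∈? ys)
indicator-∈-∷ x {y} {ys} y∉ys = by-cases (x ≟ₗ y)
  where
  by-cases : (x≟y : Dec (x ≡ y)) → indicator (x ∈? y ∷ ys) ≡ indicator x≟y + indicator (x ∈? ys)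
  by-cases (yes refl) rewrite indicator-yes (x ∈? x ∷ ys) (here refl)
                            | indicator-no (x ∈? ys) (λ x∈ys → All.lookup y∉ys x∈ys refl) = refl
  by-cases (no x≢y) =
    indicator-⇔ (λ { (here x≡y) → contradiction x≡y x≢y ; (there x∈ys) → x∈ys }) there (x ∈? y ∷ ys) (x ∈? ys)

sum-indicator-∈ : ∀ (w : List ℕ → ℕ) {xs} ys → Unique xs → Unique ys → (∀ {y} → y ∈ ys → y ∈ xs) →
                  sum (map (λ x → indicator (x ∈? ys) * w x) xs) ≡ sum (map w ys)
sum-indicator-∈ w {xs} []       _   _            _     = sum-map-zero xs (λ _ → refl)
sum-indicator-∈ w {xs} (y ∷ ys) uxs (y∉ys ∷ uys) ys⊆xs = begin
  sum (map (λ x → indicator (x ∈? y ∷ ys) * w x) xs)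
    ≡⟨ cong sum (Listₚ.map-cong (λ x → trans (cong (_* w x) (indicator-∈-∷ x y∉ys))
                                             (ℕₚ.*-distribʳ-+ (w x) (indicator (x ≟ₗ y)) (indicator (x ∈? ys)))) xs) ⟩
  sum (map (λ x → indicator (x ≟ₗ y) * w x + indicator (x ∈? ys) * w x) xs)
    ≡⟨ sum-map-+ _ _ xs ⟩
  sum (map (λ x → indicator (x ≟ₗ y) * w x) xs) + sum (map (λ x → indicator (x ∈? ys) * w x) xs)
    ≡⟨ cong₂ _+_ (sum-indicator-≡ w uxs (ys⊆xs (here refl))) (sum-indicator-∈ w ys uxs uys (ys⊆xs ∘ there)) ⟩
  w y + sum (map w ys) ∎
  where open ≡.≡-Reasoning

countWeight : ∀ {A : Set} → (A → ℕ) → List A → ℕ → ℕ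
countWeight w xs k = sum (map (λ x → indicator (w x ℕₚ.≟ k)) xs)

module _ {A : Set} where

  countWeight-cong : ∀ {w w′ : A → ℕ} xs k → (∀ {x} → x ∈ xs → w x ≡ w′ x) →
                     countWeight w xs k ≡ countWeight w′ xs k
  countWeight-cong xs k w≡w′ = sum-map-cong xs (λ x∈ → cong (λ v → indicator (v ℕₚ.≟ k)) (w≡w′ x∈))

  countWeight-shift : ∀ (w : A → ℕ) xs {m k} → m ≤ k → countWeight (λ x → m + w x) xs k ≡ countWeight w xs (k ∸ m)
  countWeight-shift w xs {m} {k} m≤k = cong sum (Listₚ.map-cong (λ x →
    indicator-⇔ (λ m+w≡k → trans (sym (ℕₚ.m+n∸m≡n m (w x))) (cong (_∸ m) m+w≡k))
                (λ w≡k-m → trans (cong (m +_) w≡k-m) (ℕₚ.m+[n∸m]≡n m≤k))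
                (m + w x ℕₚ.≟ k) (w x ℕₚ.≟ k ∸ m)) xs)

  countWeight-shift-below : ∀ (w : A → ℕ) xs {m k} → k < m → countWeight (λ x → m + w x) xs k ≡ 0
  countWeight-shift-below w xs {m} {k} k<m = sum-map-zero xs (λ {x} _ → indicator-no (m + w x ℕₚ.≟ k)
    (λ m+w≡k → ℕₚ.<⇒≱ k<m (ℕₚ.≤-trans (ℕₚ.m≤m+n m (w x)) (ℕₚ.≤-reflexive m+w≡k))))

  countWeight-map : ∀ {B : Set} (w : B → ℕ) (h : A → B) xs k →
                    countWeight w (map h xs) k ≡ countWeight (w ∘ h) xs k
  countWeight-map w h xs k = cong sum (sym (Listₚ.map-∘ xs))

  countWeight-concatMap : ∀ {B : Set} (w : B → ℕ) (g : A → List B) xs k →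
                          countWeight w (concatMap g xs) k ≡ sum (map (λ x → countWeight w (g x) k) xs)
  countWeight-concatMap w g xs k = sum-map-concatMap _ g xs

  countWeight-shift-sumTo : ∀ (w : A → ℕ) xs m k →
    countWeight (λ x → m + w x) xs k ≡ ℕΣ.sumTo k (λ j → indicator (m ℕₚ.≟ j) * countWeight w xs (k ∸ j))
  countWeight-shift-sumTo w xs m k with m ℕₚ.≤? k
  ... | yes m≤k = begin
    countWeight (λ x → m + w x) xs k
      ≡⟨ countWeight-shift w xs m≤k ⟩
    countWeight w xs (k ∸ m)
      ≡⟨ ℕₚ.*-identityˡ _ ⟨
    1 * countWeight w xs (k ∸ m)
      ≡⟨ cong (_* countWeight w xs (k ∸ m)) (indicator-yes (m ℕₚ.≟ m) refl) ⟨
    indicator (m ℕₚ.≟ m) * countWeight w xs (k ∸ m)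
      ≡⟨ ℕΣ.sumTo-single k {m} _ m≤k (λ {j} _ j≢m →
           cong (_* countWeight w xs (k ∸ j)) (indicator-no (m ℕₚ.≟ j) (j≢m ∘ sym))) ⟨
    ℕΣ.sumTo k (λ j → indicator (m ℕₚ.≟ j) * countWeight w xs (k ∸ j)) ∎
    where open ≡.≡-Reasoning
  ... | no m≰k = trans (countWeight-shift-below w xs (ℕₚ.≰⇒> m≰k)) (sym (ℕΣ.sumTo-zero k (λ {j} j≤k →
    cong (_* countWeight w xs (k ∸ j)) (indicator-no (m ℕₚ.≟ j) (λ m≡j → m≰k (subst (_≤ k) (sym m≡j) j≤k))))))

countWeight-convolution : ∀ {A B : Set} (d : A → ℕ) (e : B → ℕ) xs ys k →
  sum (map (λ x → countWeight (λ y → d x + e y) ys k) xs) ≡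
  ℕΣ.sumTo k (λ j → countWeight d xs j * countWeight e ys (k ∸ j))
countWeight-convolution d e []       ys k = sym (ℕΣ.sumTo-zero k (λ _ → refl))
countWeight-convolution d e (x ∷ xs) ys k = begin
  countWeight (λ y → d x + e y) ys k + sum (map (λ x → countWeight (λ y → d x + e y) ys k) xs)
    ≡⟨ cong₂ _+_ (countWeight-shift-sumTo e ys (d x) k) (countWeight-convolution d e xs ys k) ⟩
  ℕΣ.sumTo k (λ j → [x]ⱼ j * E j) + ℕΣ.sumTo k (λ j → countWeight d xs j * E j)
    ≡⟨ ℕΣ.sumTo-+ k _ _ ⟨
  ℕΣ.sumTo k (λ j → [x]ⱼ j * E j + countWeight d xs j * E j)
    ≡⟨ ℕΣ.sumTo-cong k (λ {j} _ → ℕₚ.*-distribʳ-+ (E j) ([x]ⱼ j) (countWeight d xs j)) ⟨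
  ℕΣ.sumTo k (λ j → countWeight d (x ∷ xs) j * E j) ∎
  where
  open ≡.≡-Reasoning
  [x]ⱼ E : ℕ → ℕ
  [x]ⱼ j = indicator (d x ℕₚ.≟ j)
  E j = countWeight e ys (k ∸ j)

oneStackCount : ℕ → ℕ → ℕ
oneStackCount n = countWeight twiceDes (oneStackPerms n)

oneStackCount-CountIs : ∀ n k →
  CountIs (λ σ → OneStack n σ × Dist σ (idPerm n) k) (perms n) (oneStackCount n k)
oneStackCount-CountIs n k = CountIs-resp
  (λ (σ∈ , twiceDes≡k) →
     ∈-oneStackPerms⁻ σ∈ , subst (Dist _ _) twiceDes≡k (OneStack-distance (∈-oneStackPerms⁻ σ∈)))
  (λ (osσ , d) → ∈-oneStackPerms⁺ osσ , Dist-unique (OneStack-distance osσ) d)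
  (subst (CountIs _ (perms n)) count-eq (CountIs-sum P? (perms n)))
  where
  P? : ∀ σ → Dec (σ ∈ oneStackPerms n × twiceDes σ ≡ k)
  P? σ = (σ ∈? oneStackPerms n) ×-dec (twiceDes σ ℕₚ.≟ k)
  count-eq : sum (map (indicator ∘ P?) (perms n)) ≡ oneStackCount n k
  count-eq = trans (cong sum (Listₚ.map-cong (λ σ → indicator-× (σ ∈? oneStackPerms n) (twiceDes σ ℕₚ.≟ k))
                                             (perms n)))
                   (sum-indicator-∈ _ (oneStackPerms n) (perms-unique n) (oneStackPerms-unique n)
                                    (λ σ∈ → OneStack⇒∈perms (∈-oneStackPerms⁻ {n} σ∈)))

-- The distance contributed by the part J after the maximum: the descent at the maximum and
-- those of J, doubled.
tailWeight : List ℕ → ℕ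
tailWeight []      = 0
tailWeight (j ∷ J) = 2 + twiceDes (j ∷ J)

des-withMax : ∀ {n p I J} → p ≤ n → OneStack p I → des (withMax n p I J) ≡ des I + des (suc n ∷ map (p +_) J)
des-withMax {n} {p} {I} {J} p≤n osI =
  des-++ I (suc n) (map (p +_) J) (All.map (λ (_ , y≤p) → s≤s (ℕₚ.≤-trans y≤p p≤n)) (OneStack-letters osI))

des-after-max : ∀ {n p j} J → p + j ≤ n → des (suc n ∷ map (p +_) (j ∷ J)) ≡ suc (des (j ∷ J))
des-after-max {n} {p} J p+j≤n =
  cong₂ _+_ (descent-< (s≤s p+j≤n)) (Shift.desFrom-map J tt (All.universal (λ _ → tt) J))
  where module Shift = StrictlyMonotoneOn {λ _ → ⊤} (p +_) (λ _ _ → ℕₚ.+-monoʳ-< p)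

twiceDes-withMax : ∀ {n p I J} → p ≤ n → OneStack p I → OneStack (n ∸ p) J →
                   twiceDes (withMax n p I J) ≡ twiceDes I + tailWeight J
twiceDes-withMax {n} {p} {I} {[]} p≤n osI osJ =
  trans (cong (λ d → d + d) (des-withMax {J = []} p≤n osI)) (arithmetic (des I))
  where
  arithmetic : ∀ a → a + 0 + (a + 0) ≡ a + a + 0
  arithmetic = solve-∀
twiceDes-withMax {n} {p} {I} {j ∷ J} p≤n osI osJ =
  trans (cong (λ d → d + d) (trans (des-withMax p≤n osI) (cong (des I +_) (des-after-max J p+j≤n))))
        (arithmetic (des I) (des (j ∷ J)))
  where
  p+j≤n : p + j ≤ n
  p+j≤n = ℕₚ.≤-trans (ℕₚ.+-monoʳ-≤ p (proj₂ (All.head (OneStack-letters osJ))))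
                     (ℕₚ.≤-reflexive (ℕₚ.m+[n∸m]≡n p≤n))
  arithmetic : ∀ a d → (a + suc d) + (a + suc d) ≡ (a + a) + (2 + (d + d))
  arithmetic = solve-∀

tailCount : ℕ → ℕ → ℕ
tailCount m = countWeight tailWeight (oneStackPerms m)

withMaxAll-count : ∀ {n p} k → p ≤ n → countWeight twiceDes (withMaxAll oneStackPerms n p) k ≡
                   ℕΣ.sumTo k (λ j → oneStackCount p j * tailCount (n ∸ p) (k ∸ j))
withMaxAll-count {n} {p} k p≤n = begin
  countWeight twiceDes (withMaxAll oneStackPerms n p) k
    ≡⟨ countWeight-concatMap twiceDes _ (oneStackPerms p) k ⟩
  sum (map (λ I → countWeight twiceDes (map (withMax n p I) (oneStackPerms (n ∸ p))) k) (oneStackPerms p))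
    ≡⟨ sum-map-cong (oneStackPerms p) (λ I∈ → trans (countWeight-map twiceDes _ (oneStackPerms (n ∸ p)) k)
         (countWeight-cong (oneStackPerms (n ∸ p)) k (λ J∈ →
           twiceDes-withMax p≤n (∈-oneStackPerms⁻ I∈) (∈-oneStackPerms⁻ J∈)))) ⟩
  sum (map (λ I → countWeight (λ J → twiceDes I + tailWeight J) (oneStackPerms (n ∸ p)) k) (oneStackPerms p))
    ≡⟨ countWeight-convolution twiceDes tailWeight (oneStackPerms p) (oneStackPerms (n ∸ p)) k ⟩
  ℕΣ.sumTo k (λ j → oneStackCount p j * tailCount (n ∸ p) (k ∸ j)) ∎
  where open ≡.≡-Reasoning

oneStackCount-suc : ∀ n k → oneStackCount (suc n) k ≡
                    ℕΣ.sumTo n (λ p → ℕΣ.sumTo k (λ j → oneStackCount p j * tailCount (n ∸ p) (k ∸ j)))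
oneStackCount-suc n k = begin
  countWeight twiceDes (oneStackPerms (suc n)) k
    ≡⟨ cong (λ L → countWeight twiceDes L k) (oneStackPerms-suc n) ⟩
  countWeight twiceDes (concatMap (withMaxAll oneStackPerms n) (upTo (suc n))) k
    ≡⟨ countWeight-concatMap twiceDes (withMaxAll oneStackPerms n) (upTo (suc n)) k ⟩
  sum (map (λ p → countWeight twiceDes (withMaxAll oneStackPerms n p) k) (upTo (suc n)))
    ≡⟨ sum-map-upTo n _ ⟩
  ℕΣ.sumTo n (λ p → countWeight twiceDes (withMaxAll oneStackPerms n p) k)
    ≡⟨ ℕΣ.sumTo-cong n (withMaxAll-count k) ⟩
  ℕΣ.sumTo n (λ p → ℕΣ.sumTo k (λ j → oneStackCount p j * tailCount (n ∸ p) (k ∸ j))) ∎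
  where open ≡.≡-Reasoning

-- The ring ℤ[[q]][[t]] of bivariate series

-- Imported only now: the prefix +_ of ℤ would make the sections (p +_) used above ambiguous.
open import Data.Integer.Base using (+_)

module ℤΣ = Sums (CommutativeRing.commutativeSemiring ℤₚ.+-*-commutativeRing)
module ℤ[[q]] = PowerSeries ℤₚ.+-*-commutativeRing
module ℤ[[q]]Σ = Sums (CommutativeRing.commutativeSemiring ℤ[[q]].commutativeRing)
module ℤ[[q]][[t]] = PowerSeries ℤ[[q]].commutativeRing

sumTo≡ℤΣ : ∀ n h → sumTo n h ≡ ℤΣ.sumTo n h
sumTo≡ℤΣ zero    h = refl
sumTo≡ℤΣ (suc n) h = cong (ℤ._+ h (suc n)) (sumTo≡ℤΣ n h)

coeff-ℤ[[q]]Σ : ∀ n h k → ℤ[[q]]Σ.sumTo n h k ≡ ℤΣ.sumTo n (λ i → h i k)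
coeff-ℤ[[q]]Σ zero    h k = refl
coeff-ℤ[[q]]Σ (suc n) h k = cong (ℤ._+ h (suc n) k) (coeff-ℤ[[q]]Σ n h k)

⊛-coeff : ∀ f g n k →
          (f ⊛ g) n k ≡ ℤΣ.sumTo n (λ i → ℤΣ.sumTo k (λ j → f i j ℤ.* g (n ∸ i) (k ∸ j)))
⊛-coeff f g n k = trans (sumTo≡ℤΣ n _) (ℤΣ.sumTo-cong n (λ _ → sumTo≡ℤΣ k _))

⊛≈⋆ : ∀ f g → f ⊛ g ≈ f ℤ[[q]][[t]].⋆ g
⊛≈⋆ f g n k = trans (⊛-coeff f g n k) (sym (coeff-ℤ[[q]]Σ n _ k))

one≈𝟙 : one ≈ ℤ[[q]][[t]].𝟙
one≈𝟙 zero    zero    = refl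
one≈𝟙 zero    (suc k) = refl
one≈𝟙 (suc n) k       = refl

module _ where

  private module R = CommutativeRing ℤ[[q]][[t]].commutativeRing
  open ℤ[[q]][[t]] using (_⋆_; 𝟙)
  open import Relation.Binary.Reasoning.Setoid R.setoid

  ⊛-cong : ∀ {f f′ g g′} → f ≈ f′ → g ≈ g′ → f ⊛ g ≈ f′ ⊛ g′
  ⊛-cong {f} {f′} {g} {g′} f≈f′ g≈g′ = begin
    f ⊛ g    ≈⟨ ⊛≈⋆ f g ⟩
    f ⋆ g    ≈⟨ R.*-cong f≈f′ g≈g′ ⟩
    f′ ⋆ g′  ≈⟨ ⊛≈⋆ f′ g′ ⟨
    f′ ⊛ g′  ∎

  ⊛-assoc : ∀ f g h → (f ⊛ g) ⊛ h ≈ f ⊛ (g ⊛ h)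
  ⊛-assoc f g h = begin
    (f ⊛ g) ⊛ h  ≈⟨ ⊛≈⋆ (f ⊛ g) h ⟩
    (f ⊛ g) ⋆ h  ≈⟨ R.*-congʳ {h} (⊛≈⋆ f g) ⟩
    (f ⋆ g) ⋆ h  ≈⟨ R.*-assoc f g h ⟩
    f ⋆ (g ⋆ h)  ≈⟨ R.*-congˡ {f} (⊛≈⋆ g h) ⟨
    f ⋆ (g ⊛ h)  ≈⟨ ⊛≈⋆ f (g ⊛ h) ⟨
    f ⊛ (g ⊛ h)  ∎

  ⊛-comm : ∀ f g → f ⊛ g ≈ g ⊛ f
  ⊛-comm f g = begin
    f ⊛ g  ≈⟨ ⊛≈⋆ f g ⟩
    f ⋆ g  ≈⟨ R.*-comm f g ⟩
    g ⋆ f  ≈⟨ ⊛≈⋆ g f ⟨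
    g ⊛ f  ∎

  ⊛-identityˡ : ∀ f → one ⊛ f ≈ f
  ⊛-identityˡ f = begin
    one ⊛ f  ≈⟨ ⊛≈⋆ one f ⟩
    one ⋆ f  ≈⟨ R.*-congʳ {f} one≈𝟙 ⟩
    𝟙 ⋆ f    ≈⟨ R.*-identityˡ f ⟩
    f        ∎

  ⊛-distribˡ : ∀ f g h → f ⊛ (g ⊕ h) ≈ f ⊛ g ⊕ f ⊛ h
  ⊛-distribˡ f g h = begin
    f ⊛ (g ⊕ h)    ≈⟨ ⊛≈⋆ f (g ⊕ h) ⟩
    f ⋆ (g ⊕ h)    ≈⟨ R.distribˡ f g h ⟩
    f ⋆ g ⊕ f ⋆ h  ≈⟨ R.+-cong (⊛≈⋆ f g) (⊛≈⋆ f h) ⟨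
    f ⊛ g ⊕ f ⊛ h  ∎

-- The product ⊛ of Defs agrees with that of ℤ[[q]][[t]] only coefficientwise, so the ring laws
-- are transported.
seriesRing : CommutativeRing 0ℓ 0ℓ
seriesRing = record
  { Carrier = Series ; _≈_ = _≈_ ; _+_ = _⊕_ ; _*_ = _⊛_ ; -_ = λ f n k → ℤ.- f n k
  ; 0# = λ _ _ → 0ℤ ; 1# = one
  ; isCommutativeRing = record
    { isRing = record
      { +-isAbelianGroup = CommutativeRing.+-isAbelianGroup ℤ[[q]][[t]].commutativeRing
      ; *-cong = ⊛-cong
      ; *-assoc = ⊛-assoc
      ; *-identity = ⊛-identityˡ , λ f n k → trans (⊛-comm f one n k) (⊛-identityˡ f n k)
      ; distrib = ⊛-distribˡ , λ f g h n k →
          trans (⊛-comm (g ⊕ h) f n k)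
                (trans (⊛-distribˡ f g h n k) (cong₂ ℤ._+_ (⊛-comm f g n k) (⊛-comm f h n k)))
      }
    ; *-comm = ⊛-comm
    }
  }

module SR = CommutativeRing seriesRing

-- term z a b is z·tᵃ·qᵇ. Definitionally mono a b = term (+ 1) a b and one = constant (+ 1),
-- so the constants of the ring solver below need no conversion.
term : ℤ → ℕ → ℕ → Series
term z a b n k = if (n ℕ.≡ᵇ a) ∧ (k ℕ.≡ᵇ b) then z else 0ℤ

term-diagonal : ∀ z a b → term z a b a b ≡ z
term-diagonal z a b rewrite ≡ᵇ-true {a} refl | ≡ᵇ-true {b} refl = refl

term-offDiagonal : ∀ z {a b i j} → i ≢ a ⊎ j ≢ b → term z a b i j ≡ 0ℤ
term-offDiagonal z (inj₁ i≢a) rewrite ≡ᵇ-false i≢a = refl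
term-offDiagonal z {a} {i = i} (inj₂ j≢b) rewrite ≡ᵇ-false j≢b with i ℕ.≡ᵇ a
... | true  = refl
... | false = refl

term-⊛ : ∀ z {a b} X n k → a ≤ n → b ≤ k → (term z a b ⊛ X) n k ≡ z ℤ.* X (n ∸ a) (k ∸ b)
term-⊛ z {a} {b} X n k a≤n b≤k = begin
  (term z a b ⊛ X) n k
    ≡⟨ ⊛-coeff (term z a b) X n k ⟩
  ℤΣ.sumTo n (λ i → ℤΣ.sumTo k (λ j → term z a b i j ℤ.* X (n ∸ i) (k ∸ j)))
    ≡⟨ ℤΣ.sumTo-single n {a} _ a≤n (λ {i} _ i≢a → ℤΣ.sumTo-zero k (λ {j} _ → vanish {i} {j} (inj₁ i≢a))) ⟩
  ℤΣ.sumTo k (λ j → term z a b a j ℤ.* X (n ∸ a) (k ∸ j))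
    ≡⟨ ℤΣ.sumTo-single k {b} _ b≤k (λ {j} _ j≢b → vanish {a} {j} (inj₂ j≢b)) ⟩
  term z a b a b ℤ.* X (n ∸ a) (k ∸ b)
    ≡⟨ cong (ℤ._* _) (term-diagonal z a b) ⟩
  z ℤ.* X (n ∸ a) (k ∸ b) ∎
  where
  open ≡.≡-Reasoning
  vanish : ∀ {i j} → i ≢ a ⊎ j ≢ b → term z a b i j ℤ.* X (n ∸ i) (k ∸ j) ≡ 0ℤ
  vanish off = cong (ℤ._* _) (term-offDiagonal z off)

term-⊛-vanishes : ∀ z {a b} X n k → n < a ⊎ k < b → (term z a b ⊛ X) n k ≡ 0ℤ
term-⊛-vanishes z {a} {b} X n k outside = trans (⊛-coeff (term z a b) X n k)
  (ℤΣ.sumTo-zero n (λ {i} i≤n → ℤΣ.sumTo-zero k (λ {j} j≤k →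
    cong (ℤ._* X (n ∸ i) (k ∸ j)) (term-offDiagonal z (offDiagonal i≤n j≤k outside)))))
  where
  offDiagonal : ∀ {i j} → i ≤ n → j ≤ k → n < a ⊎ k < b → i ≢ a ⊎ j ≢ b
  offDiagonal i≤n _ (inj₁ n<a) = inj₁ (ℕₚ.<⇒≢ (ℕₚ.≤-<-trans i≤n n<a))
  offDiagonal _ j≤k (inj₂ k<b) = inj₂ (ℕₚ.<⇒≢ (ℕₚ.≤-<-trans j≤k k<b))

constant : ℤ → Series
constant z = term z 0 0

·≈constant⊛ : ∀ z X → z · X ≈ constant z ⊛ X
·≈constant⊛ z X n k = sym (term-⊛ z X n k z≤n z≤n)

constantMorphism : ℤ.+-*-rawRing ACR.-Raw-AlmostCommutative⟶ ACR.fromCommutativeRing seriesRing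
constantMorphism = record
  { ⟦_⟧    = constant
  ; +-homo = λ a b → λ { zero zero → refl ; zero (suc k) → refl ; (suc n) k → refl }
  ; *-homo = λ a b n k → sym (trans (term-⊛ a (constant b) n k z≤n z≤n) (scale a b n k))
  ; -‿homo = λ a → λ { zero zero → refl ; zero (suc k) → refl ; (suc n) k → refl }
  ; 0-homo = λ { zero zero → refl ; zero (suc k) → refl ; (suc n) k → refl }
  ; 1-homo = λ n k → refl
  }
  where
  scale : ∀ a b n k → a ℤ.* constant b n k ≡ constant (a ℤ.* b) n k
  scale a b zero    zero    = refl
  scale a b zero    (suc k) = ℤₚ.*-zeroʳ a
  scale a b (suc n) k       = ℤₚ.*-zeroʳ a

constant≟ : ∀ a b → Maybe (constant a ≈ constant b)
constant≟ a b with a ℤₚ.≟ b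
... | yes refl = just (λ _ _ → refl)
... | no _     = nothing

module SeriesSolver =
  Algebra.Solver.Ring ℤ.+-*-rawRing (ACR.fromCommutativeRing seriesRing) constantMorphism constant≟

open SeriesSolver using (solve; _:+_; _:*_; _:-_; con; _:=_)

square-identity : ∀ F t q → let r = one ⊕ (q ⊖ one) ⊛ t ⊖ constant (+ 2) ⊛ (t ⊛ q) ⊛ F in
  r ⊛ r ≈ (q ⊖ one) ⊛ (q ⊖ one) ⊛ t ⊛ t ⊖ constant (+ 2) ⊛ (q ⊕ one) ⊛ t ⊕ one
          ⊖ constant (+ 4) ⊛ (t ⊛ q) ⊛ (F ⊖ (one ⊕ t ⊛ (F ⊛ (one ⊕ q ⊛ (F ⊖ one)))))
square-identity = solve 3 (λ F t q →
  let 𝟏 = con (+ 1)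
      r = 𝟏 :+ (q :- 𝟏) :* t :- con (+ 2) :* (t :* q) :* F
  in r :* r := (q :- 𝟏) :* (q :- 𝟏) :* t :* t :- con (+ 2) :* (q :+ 𝟏) :* t :+ 𝟏
               :- con (+ 4) :* (t :* q) :* (F :- (𝟏 :+ t :* (F :* (𝟏 :+ q :* (F :- 𝟏))))))
  (λ _ _ → refl)

sqrtCandidate : Series → Series
sqrtCandidate F = one ⊕ (Q² ⊖ one) ⊛ T ⊖ (+ 2) · (T ⊛ Q²) ⊛ F

numerator-sqrtCandidate : ∀ F → numerator (sqrtCandidate F) ≈ (+ 2) · (T ⊛ Q²) ⊛ F
numerator-sqrtCandidate F =
  solve 2 (λ a b → a :- (a :- b) := b) (λ _ _ → refl) (one ⊕ (Q² ⊖ one) ⊛ T) ((+ 2) · (T ⊛ Q²) ⊛ F)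

numerator-cong : ∀ {r s} → r ≈ s → numerator r ≈ numerator s
numerator-cong r≈s n k = cong (λ x → (one ⊕ (Q² ⊖ one) ⊛ T) n k ℤ.- x) (r≈s n k)

sqrtCandidate-square : ∀ {F} → F ≈ one ⊕ T ⊛ (F ⊛ (one ⊕ Q² ⊛ (F ⊖ one))) →
                       sqrtCandidate F ⊛ sqrtCandidate F ≈ radicand
sqrtCandidate-square {F} F-eq = begin
  sqrtCandidate F ⊛ sqrtCandidate F  ≈⟨ SR.*-cong r≈r′ r≈r′ ⟩
  r′ ⊛ r′                            ≈⟨ square-identity F T Q² ⟩
  radicand′ ⊖ 4TQ² ⊛ D               ≈⟨ SR.+-congˡ {radicand′} (SR.-‿cong 4TQ²D≈0) ⟩
  radicand′ ⊖ SR.0#                  ≈⟨ SR.+-identityʳ radicand′ ⟩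
  radicand′                          ≈⟨ radicand′≈radicand ⟩
  radicand                           ∎
  where
  open import Relation.Binary.Reasoning.Setoid SR.setoid
  A B r′ radicand′ 4TQ² D : Series
  A = one ⊕ (Q² ⊖ one) ⊛ T
  B = (Q² ⊖ one) ⊛ (Q² ⊖ one) ⊛ T ⊛ T
  r′ = A ⊖ constant (+ 2) ⊛ (T ⊛ Q²) ⊛ F
  radicand′ = B ⊖ constant (+ 2) ⊛ (Q² ⊕ one) ⊛ T ⊕ one
  4TQ² = constant (+ 4) ⊛ (T ⊛ Q²)
  D = F ⊖ (one ⊕ T ⊛ (F ⊛ (one ⊕ Q² ⊛ (F ⊖ one))))
  4TQ²D≈0 : 4TQ² ⊛ D ≈ SR.0#
  4TQ²D≈0 = SR.trans (SR.*-congˡ {4TQ²} (λ n k → ℤₚ.i≡j⇒i-j≡0 (F-eq n k))) (SR.zeroʳ 4TQ²)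
  r≈r′ : sqrtCandidate F ≈ r′
  r≈r′ n k = cong (λ x → A n k ℤ.- x) (SR.*-congʳ {F} (·≈constant⊛ (+ 2) (T ⊛ Q²)) n k)
  radicand′≈radicand : radicand′ ≈ radicand
  radicand′≈radicand n k =
    cong (λ x → B n k ℤ.- x ℤ.+ one n k) (SR.*-congʳ {T} (SR.sym (·≈constant⊛ (+ 2) (Q² ⊕ one))) n k)

coeff₀-T-multiple : ∀ {X} Y → X ≈ T ⊛ Y → ∀ k → X 0 k ≡ 0ℤ
coeff₀-T-multiple Y X≈TY k =
  trans (X≈TY 0 k) (term-⊛-vanishes (+ 1) {1} {0} Y 0 k (inj₁ (s≤s z≤n)))

sqrtCandidate-constOne : ∀ F → ConstOne (sqrtCandidate F)
sqrtCandidate-constOne F = coeff₀ 0 , λ k → coeff₀ (suc k)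
  where
  T-factor : (+ 2) · (T ⊛ Q²) ⊛ F ≈ T ⊛ (constant (+ 2) ⊛ Q² ⊛ F)
  T-factor = SR.trans (SR.*-congʳ {F} (·≈constant⊛ (+ 2) (T ⊛ Q²)))
    (solve 3 (λ t q f → con (+ 2) :* (t :* q) :* f := t :* (con (+ 2) :* q :* f)) (λ _ _ → refl) T Q² F)
  coeff₀ : ∀ k → sqrtCandidate F 0 k ≡ one 0 k
  coeff₀ k = begin
    one 0 k ℤ.+ ((Q² ⊖ one) ⊛ T) 0 k ℤ.- ((+ 2) · (T ⊛ Q²) ⊛ F) 0 k
      ≡⟨ cong₂ (λ x y → one 0 k ℤ.+ x ℤ.- y) (coeff₀-T-multiple (Q² ⊖ one) (SR.*-comm (Q² ⊖ one) T) k)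
                                              (coeff₀-T-multiple (constant (+ 2) ⊛ Q² ⊛ F) T-factor k) ⟩
    one 0 k ℤ.+ 0ℤ ℤ.+ 0ℤ
      ≡⟨ trans (ℤₚ.+-identityʳ _) (ℤₚ.+-identityʳ _) ⟩
    one 0 k ∎
    where open ≡.≡-Reasoning

-- Lexicographic induction on (n, k): once the earlier coefficients of X vanish,
-- (X ⊛ Y) n k = X n k · Y 0 0.
⊛≈0⇒≈0 : ∀ {X Y} → Y 0 0 ≢ 0ℤ → X ⊛ Y ≈ SR.0# → X ≈ SR.0#
⊛≈0⇒≈0 {X} {Y} Y₀₀≢0 XY≈0 n k = <-rec (λ n → ∀ k → X n k ≡ 0ℤ)
  (λ n rows → <-rec (λ k → X n k ≡ 0ℤ) (λ k cols → cancel (leading rows cols))) n k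
  where
  instance
    Y₀₀-nonZero : ℤ.NonZero (Y 0 0)
    Y₀₀-nonZero = ℤ.≢-nonZero Y₀₀≢0
  leading : ∀ {n k} → (∀ {i} → i < n → ∀ j → X i j ≡ 0ℤ) → (∀ {j} → j < k → X n j ≡ 0ℤ) →
            (X ⊛ Y) n k ≡ X n k ℤ.* Y 0 0
  leading {n} {k} rows cols = begin
    (X ⊛ Y) n k
      ≡⟨ ⊛-coeff X Y n k ⟩
    ℤΣ.sumTo n (λ i → ℤΣ.sumTo k (λ j → X i j ℤ.* Y (n ∸ i) (k ∸ j)))
      ≡⟨ ℤΣ.sumTo-single n {n} _ ℕₚ.≤-refl (λ {i} i≤n i≢n → ℤΣ.sumTo-zero k (λ {j} _ →
           cong (ℤ._* Y (n ∸ i) (k ∸ j)) (rows (ℕₚ.≤∧≢⇒< i≤n i≢n) j))) ⟩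
    ℤΣ.sumTo k (λ j → X n j ℤ.* Y (n ∸ n) (k ∸ j))
      ≡⟨ ℤΣ.sumTo-single k {k} _ ℕₚ.≤-refl (λ {j} j≤k j≢k →
           cong (ℤ._* Y (n ∸ n) (k ∸ j)) (cols (ℕₚ.≤∧≢⇒< j≤k j≢k))) ⟩
    X n k ℤ.* Y (n ∸ n) (k ∸ k)
      ≡⟨ cong₂ (λ a b → X n k ℤ.* Y a b) (ℕₚ.n∸n≡0 n) (ℕₚ.n∸n≡0 k) ⟩
    X n k ℤ.* Y 0 0 ∎
    where open ≡.≡-Reasoning
  cancel : ∀ {n k} → (X ⊛ Y) n k ≡ X n k ℤ.* Y 0 0 → X n k ≡ 0ℤ
  cancel {n} {k} eq = ℤₚ.*-cancelʳ-≡ (X n k) 0ℤ (Y 0 0) (trans (sym eq) (XY≈0 n k))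

sqrt-unique : ∀ {r s} → IsSqrt r → IsSqrt s → r ≈ s
sqrt-unique {r} {s} ((r₀₀ , _) , r²) ((s₀₀ , _) , s²) n k =
  ℤₚ.i-j≡0⇒i≡j (r n k) (s n k) (⊛≈0⇒≈0 {r ⊖ s} {r ⊕ s} r+s≢0 [r-s][r+s]≈0 n k)
  where
  r+s≢0 : (r ⊕ s) 0 0 ≢ 0ℤ
  r+s≢0 rewrite r₀₀ | s₀₀ = λ ()
  [r-s][r+s]≈0 : (r ⊖ s) ⊛ (r ⊕ s) ≈ SR.0#
  [r-s][r+s]≈0 = SR.trans (solve 2 (λ a b → (a :- b) :* (a :+ b) := a :* a :- b :* b) (λ _ _ → refl) r s)
                          (λ n k → ℤₚ.i≡j⇒i-j≡0 (trans (r² n k) (sym (s² n k))))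

-- The generating function

pos-sumTo : ∀ n h → + ℕΣ.sumTo n h ≡ ℤΣ.sumTo n (λ i → + h i)
pos-sumTo zero    h = refl
pos-sumTo (suc n) h =
  trans (ℤₚ.pos-+ (ℕΣ.sumTo n h) (h (suc n))) (cong (ℤ._+ + h (suc n)) (pos-sumTo n h))

Q²⊛-shift : ∀ X m k → (Q² ⊛ X) m (2 + k) ≡ X m k
Q²⊛-shift X m k = trans (term-⊛ (+ 1) X m (2 + k) z≤n (s≤s (s≤s z≤n))) (ℤₚ.*-identityˡ (X m k))

Q²⊛-low : ∀ X m k → k < 2 → (Q² ⊛ X) m k ≡ 0ℤ
Q²⊛-low X m k k<2 = term-⊛-vanishes (+ 1) {0} {2} X m k (inj₂ k<2)

tailCount-suc : ∀ m k → tailCount (suc m) k ≡ countWeight (λ J → 2 + twiceDes J) (oneStackPerms (suc m)) k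
tailCount-suc m k = countWeight-cong (oneStackPerms (suc m)) k nonEmpty
  where
  nonEmpty : ∀ {J} → J ∈ oneStackPerms (suc m) → tailWeight J ≡ 2 + twiceDes J
  nonEmpty {[]}    J∈ = contradiction (OneStack-[]⇒0 (∈-oneStackPerms⁻ {suc m} J∈) refl) λ ()
  nonEmpty {_ ∷ _} _  = refl

oneStackSeries : Series
oneStackSeries = fromCoeffs oneStackCount

tailSeries : Series
tailSeries = one ⊕ Q² ⊛ (oneStackSeries ⊖ one)

tailSeries-coeff : ∀ m k → tailSeries m k ≡ + tailCount m k
tailSeries-coeff zero    zero          rewrite Q²⊛-low (oneStackSeries ⊖ one) 0 0 (s≤s z≤n) = refl
tailSeries-coeff zero    (suc zero)    rewrite Q²⊛-low (oneStackSeries ⊖ one) 0 1 (s≤s (s≤s z≤n)) = refl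
tailSeries-coeff zero    (suc (suc k)) rewrite Q²⊛-shift (oneStackSeries ⊖ one) 0 k with k
... | zero  = refl
... | suc _ = refl
tailSeries-coeff (suc m) k with k
... | zero  rewrite Q²⊛-low (oneStackSeries ⊖ one) (suc m) 0 (s≤s z≤n) | tailCount-suc m 0 =
  cong +_ (sym (countWeight-shift-below twiceDes (oneStackPerms (suc m)) {2} {0} (s≤s z≤n)))
... | suc zero rewrite Q²⊛-low (oneStackSeries ⊖ one) (suc m) 1 (s≤s (s≤s z≤n)) | tailCount-suc m 1 =
  cong +_ (sym (countWeight-shift-below twiceDes (oneStackPerms (suc m)) {2} {1} (s≤s (s≤s z≤n))))
... | suc (suc k) rewrite Q²⊛-shift (oneStackSeries ⊖ one) (suc m) k | tailCount-suc m (2 + k) =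
  trans (ℤₚ.+-identityʳ _)
        (cong +_ (sym (countWeight-shift twiceDes (oneStackPerms (suc m)) {2} {2 + k} (s≤s (s≤s z≤n)))))

oneStackSeries-equation : oneStackSeries ≈ one ⊕ T ⊛ (oneStackSeries ⊛ tailSeries)
oneStackSeries-equation zero k
  rewrite term-⊛-vanishes (+ 1) {1} {0} (oneStackSeries ⊛ tailSeries) 0 k (inj₁ (s≤s z≤n)) with k
... | zero  = refl
... | suc _ = refl
oneStackSeries-equation (suc n) k = begin
  + oneStackCount (suc n) k
    ≡⟨ cong +_ (oneStackCount-suc n k) ⟩
  + ℕΣ.sumTo n (λ p → ℕΣ.sumTo k (λ j → oneStackCount p j * tailCount (n ∸ p) (k ∸ j)))
    ≡⟨ pos-sumTo n _ ⟩
  ℤΣ.sumTo n (λ p → + ℕΣ.sumTo k (λ j → oneStackCount p j * tailCount (n ∸ p) (k ∸ j)))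
    ≡⟨ ℤΣ.sumTo-cong n (λ {p} _ → trans (pos-sumTo k _) (ℤΣ.sumTo-cong k (λ {j} _ →
         trans (ℤₚ.pos-* (oneStackCount p j) _)
               (cong (+ oneStackCount p j ℤ.*_) (sym (tailSeries-coeff (n ∸ p) (k ∸ j))))))) ⟩
  ℤΣ.sumTo n (λ p → ℤΣ.sumTo k (λ j → oneStackSeries p j ℤ.* tailSeries (n ∸ p) (k ∸ j)))
    ≡⟨ ⊛-coeff oneStackSeries tailSeries n k ⟨
  (oneStackSeries ⊛ tailSeries) n k
    ≡⟨ ℤₚ.*-identityˡ _ ⟨
  + 1 ℤ.* (oneStackSeries ⊛ tailSeries) n k
    ≡⟨ term-⊛ (+ 1) (oneStackSeries ⊛ tailSeries) (suc n) k (s≤s z≤n) z≤n ⟨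
  (T ⊛ (oneStackSeries ⊛ tailSeries)) (suc n) k
    ≡⟨ ℤₚ.+-identityˡ _ ⟨
  (one ⊕ T ⊛ (oneStackSeries ⊛ tailSeries)) (suc n) k ∎
  where open ≡.≡-Reasoning

mainTheorem8 : Σ (ℕ → ℕ → ℕ) (λ c →
                 ((n k : ℕ) → CountIs (λ σ → OneStack n σ × Dist σ (idPerm n) k) (perms n) (c n k))
                 × Σ Series IsSqrt
                 × ((r : Series) → IsSqrt r →
                      numerator r ≈ ((+ 2) · (T ⊛ Q²) ⊛ fromCoeffs c)))
mainTheorem8 = oneStackCount , oneStackCount-CountIs , (r₀ , r₀-isSqrt) , numerator-of-sqrt
  where
  r₀ : Series
  r₀ = sqrtCandidate oneStackSeries
  r₀-isSqrt : IsSqrt r₀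
  r₀-isSqrt = sqrtCandidate-constOne oneStackSeries , sqrtCandidate-square oneStackSeries-equation
  numerator-of-sqrt : ∀ r → IsSqrt r → numerator r ≈ (+ 2) · (T ⊛ Q²) ⊛ oneStackSeries
  numerator-of-sqrt r r-isSqrt n k =
    trans (numerator-cong {r} {r₀} (sqrt-unique {r} {r₀} r-isSqrt r₀-isSqrt) n k)
          (numerator-sqrtCandidate oneStackSeries n k)
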